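{- Let $r\ge1$ and let $(Q_{a,k})_{a\in[1,r],k\in\mathbb{Z}}$ be nonzero complex numbers satisfying the $A_r$ Q-system $$Q_{a,k+1}Q_{a,k-1}=Q_{a,k}^2+Q_{a+1,k}Q_{a-1,k}\quad(a\in[1,r],\ k\in\mathbb{Z}),\qquad Q_{0,k}=Q_{r+1,k}=1.$$ Then for every $h\in H_1(\mathbb{T},\mathbb{Z})$ and every $k\in\mathbb{Z}$, $$H_h(Q_{1,k},\dots,Q_{r,k},Q_{1,k+1},\dots,Q_{r,k+1})=H_h(Q_{1,k+1},\dots,Q_{r,k+1},Q_{1,k+2},\dots,Q_{r,k+2}),$$ i.e. the functions $H_h$ are conserved quantities of the $A_r$ Q-system dynamics $Q_{a,k}\mapsto Q_{a,k+1}$.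
   Context: Let $\mathbb{T}=\mathbb{R}^2/(2\mathbb{Z}\times(r+1)\mathbb{Z})$. Let $G$ be the bipartite graph embedded in $\mathbb{T}$ with vertices $(x,y)$, $x\in\{0,1\}$ (mod 2), $y\in\{0,1,\dots,r\}$, where $(x,y)$ is black if $x+y$ is odd and white otherwise. Edges: for each $y\in\{0,\dots,r\}$, the two horizontal segments $[0,1]\times\{y\}$ and $[1,2]\times\{y\}$ (both joining $(0,y)$ and $(1,y)$); for each $y\in\{0,\dots,r-1\}$ and $x\in\{0,1\}$, the vertical segment $\{x\}\times[y,y+1]$. Faces: the annulus $(\mathbb{R}/2\mathbb{Z})\times(r,r+1)$ is labeled $0$; for $a\in[1,r]$, if $a$ is odd the square $(0,1)\times(a-1,a)$ is labeled $a$ and $(1,2)\times(a-1,a)$ is labeled $r+a$, and if $a$ is even the square $(1,2)\times(a-1,a)$ is labeled $a$ and $(0,1)\times(a-1,a)$ is labeled $r+a$. Face $0$ has weight $A_0:=1$ and face $i\in[1,2r]$ has weight $A_i\in\mathbb{C}^*$. Weight of a perfect matching $M$: $w(M)=\prod_{e\in M}(A_iA_j)^{ -1}$, where $i,j$ are the faces on the two sides of $e$. Reference matching $M_0$: for each $y\in\{0,\dots,r\}$, the one horizontal edge at height $y$ whose left endpoint ($(0,y)$ for $[0,1]\times\{y\}$, $(1,y)$ for $[1,2]\times\{y\}$) is black. For a perfect matching $M$, orient the edges of $M$ from black to white and those of $M_0$ from white to black, discard common edges; $[M]_{M_0}\in H_1(\mathbb{T},\mathbb{Z})$ is the homology class of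 the resulting union of oriented loops. The Hamiltonian is $H_h(A_1,\dots,A_{2r})=\sum_{M:[M]_{M_0}=h}w(M)/w(M_0)$ over perfect matchings $M$ of $G$. -}

module Defs where

open import Level using (Level; _⊔_)
open import Data.Bool using (Bool; true; false; if_then_else_; _∧_; not; _xor_)
open import Data.Nat as ℕ using (ℕ; zero; suc; _∸_; _≤ᵇ_; _≡ᵇ_)
open import Data.Fin using (Fin; toℕ; fromℕ<)
import Data.Fin as Fin
open import Data.Integer as ℤ using (ℤ; +_; -[1+_])
open import Data.Product using (_×_; _,_; proj₁; proj₂)
open import Data.List using (List; []; _∷_; map; concatMap; foldr; allFin)
import Data.Vec.Functional as VF
open import Relation.Nullary using (¬_)
open import Relation.Nullary.Decidable using (⌊_⌋)
open import Algebra.Bundles using (CommutativeRing)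

-- Fields (not in agda-stdlib): a commutative ring with 0 ≠ 1 in which
-- every nonzero element has a multiplicative inverse.  The inverse is a
-- total function whose value at 0 is irrelevant.

record Field (c ℓ : Level) : Set (Level.suc (c ⊔ ℓ)) where
  field
    commutativeRing : CommutativeRing c ℓ
  open CommutativeRing commutativeRing public
  field
    _⁻¹       : Carrier → Carrier
    ⁻¹-inverse : ∀ x → ¬ (x ≈ 0#) → (x * (x ⁻¹)) ≈ 1#
    0≉1       : ¬ (0# ≈ 1#)

-- Edge subsets of the graph G (for a given r).
--   hor y c : horizontal edge at height y; c = 0 is [0,1]×{y}, c = 1 is [1,2]×{y}
--   ver y x : vertical edge {x}×[y,y+1]   (y ∈ [0,r-1])

record EdgeSet (r : ℕ) : Set where
  constructor edgeSet
  field
    hor : Fin (suc r) → Fin 2 → Bool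
    ver : Fin r → Fin 2 → Bool
open EdgeSet public

allFuns : {B : Set} → (m : ℕ) → List B → List (Fin m → B)
allFuns zero    bs = (λ ()) ∷ []
allFuns (suc m) bs = concatMap (λ b → map (λ f → b VF.∷ f) (allFuns m bs)) bs

bools : List Bool
bools = false ∷ true ∷ []

allEdgeSets : (r : ℕ) → List (EdgeSet r)
allEdgeSets r =
  concatMap (λ h → map (λ v → edgeSet h v) (allFuns r (allFuns 2 bools)))
            (allFuns (suc r) (allFuns 2 bools))

atℕ : {A : Set} {n : ℕ} → (Fin n → A) → A → ℕ → A
atℕ {n = zero}  f d i       = d
atℕ {n = suc n} f d zero    = f Fin.zero
atℕ {n = suc n} f d (suc i) = atℕ (λ j → f (Fin.suc j)) d i

χ : Bool → ℕ
χ true  = 1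
χ false = 0

χℤ : Bool → ℤ
χℤ b = + (χ b)

verℕ : {r : ℕ} → EdgeSet r → ℕ → Fin 2 → Bool
verℕ M y x = atℕ (λ j → ver M j x) false y

degree : {r : ℕ} → EdgeSet r → Fin 2 → Fin (suc r) → ℕ
degree M x y =
  χ (hor M y Fin.zero) ℕ.+ χ (hor M y (Fin.suc Fin.zero))
  ℕ.+ χ (verℕ M (toℕ y) x) ℕ.+ below (toℕ y)
  where
    below : ℕ → ℕ
    below zero    = 0
    below (suc y') = χ (verℕ M y' x)

allB : {A : Set} → (A → Bool) → List A → Bool
allB p = foldr (λ a b → p a ∧ b) true

isPerfectMatching : {r : ℕ} → EdgeSet r → Bool
isPerfectMatching {r} M =
  allB (λ x → allB (λ y → degree M x y ≡ᵇ 1) (allFin (suc r))) (allFin 2)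

odd : ℕ → Bool
odd zero    = false
odd (suc n) = not (odd n)

black : Fin 2 → ℕ → Bool
black x y = odd (toℕ x ℕ.+ y)

-- reference matching M₀: at height y, the horizontal edge whose left endpoint
-- is black ((0,y) for column 0, (1,y) for column 1)
M₀ : (r : ℕ) → EdgeSet r
M₀ r = edgeSet (λ y c → black c (toℕ y)) (λ _ _ → false)

sumℤ : List ℤ → ℤ
sumℤ = foldr ℤ._+_ (+ 0)

sgn : Bool → ℤ
sgn true  = + 1
sgn false = -[1+ 0 ]

-- Homology class [M]_{M₀} ∈ H₁(𝕋,ℤ) ≅ ℤ × ℤ, in the basis
-- (horizontal loop t ↦ (t, y₀) in the +x direction, vertical loop t ↦ (x₀, t) in +y direction).
-- Coordinates are computed as algebraic intersection numbers of the oriented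
-- 1-cycle (M oriented black→white, M₀ oriented white→black) with
--   * the vertical circle {1/2}×ℝ  (met only by the edges [0,1]×{y}), counting
--     left-to-right crossings positively: first coordinate;
--   * the horizontal circle ℝ×{1/2} (met only by the edges {x}×[0,1]), counting
--     upward crossings positively: second coordinate.
-- An edge of M at [0,1]×{y} goes left→right iff (0,y) is black; an edge of M₀
-- has the opposite orientation.  Common edges cancel, matching "discard common edges".
homologyClass : {r : ℕ} → EdgeSet r → ℤ × ℤ
homologyClass {r} M = c₁ , c₂
  where
    c₁ : ℤ
    c₁ = sumℤ (map (λ y → sgn (black Fin.zero (toℕ y)) ℤ.*
                          (χℤ (hor M y Fin.zero) ℤ.- χℤ (hor (M₀ r) y Fin.zero)))
                   (allFin (suc r)))
    c₂ : ℤ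
    c₂ = sumℤ (map (λ x → sgn (black x 0) ℤ.*
                          (χℤ (verℕ M 0 x) ℤ.- χℤ (verℕ (M₀ r) 0 x)))
                   (allFin 2))

-- Square in column c (c = 0: (0,1), c = 1: (1,2)) and row a ∈ [1,r]
-- (i.e. ×(a-1,a)): for a odd, column 0 ↦ a, column 1 ↦ r+a; for a even, column 1 ↦ a,
-- column 0 ↦ r+a.  Face 0 is the annulus (r,r+1).
squareLabel : (r : ℕ) → Fin 2 → ℕ → ℕ
squareLabel r c a = if (odd a xor odd (toℕ c)) then a else r ℕ.+ a

horFaces : (r : ℕ) → Fin 2 → ℕ → ℕ × ℕ
horFaces r c y = below y , above
  where
    below : ℕ → ℕ
    below zero     = 0
    below (suc y') = squareLabel r c (suc y')
    above : ℕ
    above = if y ≡ᵇ r then 0 else squareLabel r c (suc y)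

verFaces : (r : ℕ) → Fin 2 → ℕ → ℕ × ℕ
verFaces r x y = squareLabel r Fin.zero (suc y) , squareLabel r (Fin.suc Fin.zero) (suc y)

module Hamiltonian {c ℓ : Level} (F : Field c ℓ) where
  open Field F using (Carrier; _≈_; _+_; _*_; 0#; 1#; _⁻¹)

  prod : List Carrier → Carrier
  prod = foldr _*_ 1#

  sum : List Carrier → Carrier
  sum = foldr _+_ 0#

  faceWeight : (ℕ → Carrier) → ℕ → Carrier
  faceWeight A zero    = 1#
  faceWeight A (suc i) = A (suc i)

  edgeWeight : (ℕ → Carrier) → ℕ × ℕ → Carrier
  edgeWeight A (i , j) = (faceWeight A i * faceWeight A j) ⁻¹

  weight : {r : ℕ} → (ℕ → Carrier) → EdgeSet r → Carrier
  weight {r} A M =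
    prod (concatMap (λ y → map (λ c → if hor M y c then edgeWeight A (horFaces r c (toℕ y)) else 1#)
                               (allFin 2))
                    (allFin (suc r)))
    * prod (concatMap (λ y → map (λ x → if ver M y x then edgeWeight A (verFaces r x (toℕ y)) else 1#)
                                 (allFin 2))
                      (allFin r))

  H : (r : ℕ) → ℤ × ℤ → (ℕ → Carrier) → Carrier
  H r (h₁ , h₂) A =
    sum (map (λ M → if isPerfectMatching M ∧ ⌊ proj₁ (homologyClass M) ℤ.≟ h₁ ⌋
                                            ∧ ⌊ proj₂ (homologyClass M) ℤ.≟ h₂ ⌋
                    then weight A M * (weight A (M₀ r)) ⁻¹
                    else 0#)
             (allEdgeSets r))

  qArgs : (r : ℕ) → (ℕ → ℤ → Carrier) → ℤ → ℕ → Carrier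
  qArgs r Q k i = if i ≤ᵇ r then Q i k else Q (i ∸ r) (k ℤ.+ + 1)

-- The perfect matchings of the ladder G are read off row by row: a row is covered by one of its
-- two horizontal edges, by the pair of vertical edges leading to the next row, or, when the row
-- below sent its vertical pair up, by nothing.  So every perfect matching has vertical homology
-- coordinate 0, and a transfer-matrix summation turns H_(h₁,0) · w(M₀) into the coefficient of
-- z^h₁ in a continuant whose steps carry the weights of the reference edge, of the other
-- horizontal edge and of the vertical pair.  Dividing by w(M₀) leaves the monic continuant with
-- t_m = X_m Y_(m+1) / (Y_m X_(m+1)) and d_m = X_m Y_(m+2) / (X_(m+1) Y_(m+1)), where X_a and Y_a
-- are the weights of the faces labelled a and r + a.
-- For X = Q_(·,k), Y = Q_(·,k+1), Z = Q_(·,k+2) put D_m = Y_(m-1) Z_(m+1) / (Y_m Z_m).  The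
-- Q-system relation gives t′_m + D_m = t_m + d_m and D_(m+1) t_m = d_m t′_(m+1), where t′ and
-- d′_m = D_(m+1) are the coefficients at time k + 1.  These identities rewrite one continuant into
-- the other step by step, K(n+1, m) = K′(n+1, m) + D_m z⁻¹ K′(n, m+1), and D_0 = 0.

module Submission where

open import Defs
open import Level using (0ℓ)
open import Data.Bool using (Bool; true; false; if_then_else_; _∧_; not; _xor_; T)
open import Data.Nat as ℕ using (ℕ; zero; suc; _≤_; _<_; z≤n; s≤s; _∸_; _≡ᵇ_; _≤ᵇ_)
import Data.Nat.Properties as ℕₚ
import Data.Bool.Properties as Boolₚ
open import Data.Fin as Fin using (Fin; toℕ)
open import Data.Integer as ℤ using (ℤ; +_)
import Data.Integer.Properties as ℤₚ
open import Data.List using (List; []; _∷_; map; foldr; _++_; concatMap; tabulate; allFin)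
open import Data.Bool.ListAction using (and)
import Data.List.Properties as Listₚ
import Data.Vec.Functional as Vector
open import Data.Product using (_×_; _,_; proj₁; proj₂)
open import Data.Sum using (_⊎_; inj₁; inj₂)
open import Data.Unit using (tt)
open import Data.Empty using (⊥-elim)
open import Function using (_∘_; Equivalence)
open import Relation.Nullary using (¬_; yes; no)
open import Relation.Nullary.Decidable using (⌊_⌋)
open import Relation.Binary.PropositionalEquality as ≡ using (_≡_)
open import Algebra.Bundles using (CommutativeRing)
import Algebra.Properties.CommutativeSemigroup as CommutativeSemigroupProperties
import Algebra.Solver.Ring.NaturalCoefficients.Default as NatSolver
import Data.Integer.Tactic.RingSolver as ℤ-Solver
import Relation.Binary.Reasoning.Setoid as SetoidReasoning

module Sums {c ℓ} (R : CommutativeRing c ℓ) where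
  open CommutativeRing R hiding (zero)

  when : Bool → Carrier → Carrier
  when b x = if b then x else 0#

  when-cong : ∀ b {x y} → x ≈ y → when b x ≈ when b y
  when-cong true  x≈y = x≈y
  when-cong false x≈y = refl

  when-*ˡ : ∀ b x y → x * when b y ≈ when b (x * y)
  when-*ˡ true  x y = refl
  when-*ˡ false x y = zeroʳ x

  when-*ʳ : ∀ b x y → when b x * y ≈ when b (x * y)
  when-*ʳ true  x y = refl
  when-*ʳ false x y = zeroˡ y

  when-∧ : ∀ a b x → when (a ∧ b) x ≡ when a (when b x)
  when-∧ true  b x = ≡.refl
  when-∧ false b x = ≡.refl

  ∑ : ∀ {a} {A : Set a} → List A → (A → Carrier) → Carrier
  ∑ xs f = foldr _+_ 0# (map f xs)

  ∏ : List Carrier → Carrier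
  ∏ = foldr _*_ 1#

  ∑-cong : ∀ {a} {A : Set a} {f g : A → Carrier} xs → (∀ x → f x ≈ g x) → ∑ xs f ≈ ∑ xs g
  ∑-cong []       f≈g = refl
  ∑-cong (x ∷ xs) f≈g = +-cong (f≈g x) (∑-cong xs f≈g)

  ∑-map : ∀ {a b} {A : Set a} {B : Set b} (g : A → B) (f : B → Carrier) xs →
          ∑ (map g xs) f ≡ ∑ xs (f ∘ g)
  ∑-map g f xs = ≡.cong (foldr _+_ 0#) (≡.sym (Listₚ.map-∘ xs))

  ∑-++ : ∀ {a} {A : Set a} (f : A → Carrier) xs ys → ∑ (xs ++ ys) f ≈ ∑ xs f + ∑ ys f
  ∑-++ f []       ys = sym (+-identityˡ _)
  ∑-++ f (x ∷ xs) ys = trans (+-congˡ (∑-++ f xs ys)) (sym (+-assoc _ _ _))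

  ∑-concatMap : ∀ {a b} {A : Set a} {B : Set b} (g : A → List B) (f : B → Carrier) xs →
                ∑ (concatMap g xs) f ≈ ∑ xs (λ x → ∑ (g x) f)
  ∑-concatMap g f []       = refl
  ∑-concatMap g f (x ∷ xs) = trans (∑-++ f (g x) (concatMap g xs)) (+-congˡ (∑-concatMap g f xs))

  ∑-0 : ∀ {a} {A : Set a} (xs : List A) → ∑ xs (λ _ → 0#) ≈ 0#
  ∑-0 []       = refl
  ∑-0 (x ∷ xs) = trans (+-identityˡ _) (∑-0 xs)

  ∑-+ : ∀ {a} {A : Set a} (f g : A → Carrier) xs → ∑ xs (λ x → f x + g x) ≈ ∑ xs f + ∑ xs g
  ∑-+ f g []       = sym (+-identityˡ 0#)
  ∑-+ f g (x ∷ xs) = trans (+-congˡ (∑-+ f g xs)) (interchange (f x) (g x) (∑ xs f) (∑ xs g))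
    where open CommutativeSemigroupProperties +-commutativeSemigroup using (interchange)

  ∑-comm : ∀ {a b} {A : Set a} {B : Set b} (f : A → B → Carrier) xs ys →
           ∑ xs (λ x → ∑ ys (f x)) ≈ ∑ ys (λ y → ∑ xs (λ x → f x y))
  ∑-comm f []       ys = sym (∑-0 ys)
  ∑-comm f (x ∷ xs) ys = trans (+-congˡ (∑-comm f xs ys)) (sym (∑-+ (f x) _ ys))

  ∑-*ˡ : ∀ {a} {A : Set a} c (f : A → Carrier) xs → ∑ xs (λ x → c * f x) ≈ c * ∑ xs f
  ∑-*ˡ c f []       = sym (zeroʳ c)
  ∑-*ˡ c f (x ∷ xs) = trans (+-congˡ (∑-*ˡ c f xs)) (sym (distribˡ c (f x) (∑ xs f)))

  ∑-*ʳ : ∀ {a} {A : Set a} c (f : A → Carrier) xs → ∑ xs (λ x → f x * c) ≈ ∑ xs f * c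
  ∑-*ʳ c f []       = sym (zeroˡ c)
  ∑-*ʳ c f (x ∷ xs) = trans (+-congˡ (∑-*ʳ c f xs)) (sym (distribʳ c (f x) (∑ xs f)))

  ∑-when : ∀ {a} {A : Set a} b (f : A → Carrier) xs → ∑ xs (λ x → when b (f x)) ≈ when b (∑ xs f)
  ∑-when true  f xs = refl
  ∑-when false f xs = ∑-0 xs

  ∑-allFuns : ∀ {B : Set} m (bs : List B) (f : (Fin (suc m) → B) → Carrier) →
              ∑ (allFuns (suc m) bs) f ≈ ∑ bs (λ x → ∑ (allFuns m bs) (λ g → f (x Vector.∷ g)))
  ∑-allFuns m bs f = trans (∑-concatMap (λ x → map (x Vector.∷_) (allFuns m bs)) f bs)
                           (∑-cong bs (λ x → reflexive (∑-map (x Vector.∷_) f (allFuns m bs))))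

  ∏-++ : ∀ xs ys → ∏ (xs ++ ys) ≈ ∏ xs * ∏ ys
  ∏-++ []       ys = sym (*-identityˡ _)
  ∏-++ (x ∷ xs) ys = trans (*-congˡ (∏-++ xs ys)) (sym (*-assoc _ _ _))

  ∏-concatMap-tabulate : ∀ {a n} {A : Set a} (g : A → List Carrier) (f : Fin n → A) →
                         ∏ (concatMap g (tabulate f)) ≈ ∏ (tabulate (∏ ∘ g ∘ f))
  ∏-concatMap-tabulate {n = zero}  g f = refl
  ∏-concatMap-tabulate {n = suc n} g f = trans (∏-++ (g (f Fin.zero)) _) (*-congˡ (∏-concatMap-tabulate g (f ∘ Fin.suc)))

  ∏-tabulate-* : ∀ {n} (f g : Fin n → Carrier) → ∏ (tabulate f) * ∏ (tabulate g) ≈ ∏ (tabulate (λ i → f i * g i))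
  ∏-tabulate-* {zero}  f g = *-identityˡ 1#
  ∏-tabulate-* {suc n} f g = trans (interchange (f Fin.zero) _ (g Fin.zero) _)
                                    (*-congˡ (∏-tabulate-* (f ∘ Fin.suc) (g ∘ Fin.suc)))
    where open CommutativeSemigroupProperties *-commutativeSemigroup using (interchange)

  ∏-tabulate-extend : ∀ n (f : ℕ → Carrier) → f n ≈ 1# →
                      ∏ (tabulate {n = n} (f ∘ toℕ)) ≈ ∏ (tabulate {n = suc n} (f ∘ toℕ))
  ∏-tabulate-extend zero    f fn≈1 = sym (trans (*-identityʳ _) fn≈1)
  ∏-tabulate-extend (suc n) f fn≈1 = *-congˡ (∏-tabulate-extend n (f ∘ suc) fn≈1)

  prodFrom : (ℕ → Carrier) → ℕ → ℕ → Carrier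
  prodFrom a zero    m = 1#
  prodFrom a (suc n) m = a m * prodFrom a n (suc m)

  ∏-tabulate≈prodFrom : ∀ (a : ℕ → Carrier) n m → ∏ (tabulate {n = n} λ y → a (toℕ y ℕ.+ m)) ≈ prodFrom a n m
  ∏-tabulate≈prodFrom a zero    m = refl
  ∏-tabulate≈prodFrom a (suc n) m = *-congˡ (trans
    (reflexive (≡.cong ∏ (Listₚ.tabulate-cong {n = n} λ y → ≡.cong a (≡.sym (ℕₚ.+-suc (toℕ y) m)))))
    (∏-tabulate≈prodFrom a n (suc m)))

module Fractions (F : Field 0ℓ 0ℓ) where
  open Field F hiding (zero)
  open Sums commutativeRing using (prodFrom)
  open SetoidReasoning setoid
  open NatSolver commutativeSemiring
  open CommutativeSemigroupProperties *-commutativeSemigroup using (interchange)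

  NonZero : Carrier → Set
  NonZero x = ¬ (x ≈ 0#)

  _/_ : Carrier → Carrier → Carrier
  x / y = x * y ⁻¹

  1≉0 : NonZero 1#
  1≉0 1≈0 = 0≉1 (sym 1≈0)

  nonZero-cong : ∀ {x y} → x ≈ y → NonZero x → NonZero y
  nonZero-cong x≈y x≉0 y≈0 = x≉0 (trans x≈y y≈0)

  *-inverseʳ : ∀ {x} → NonZero x → x * x ⁻¹ ≈ 1#
  *-inverseʳ {x} = ⁻¹-inverse x

  *-inverseˡ : ∀ {x} → NonZero x → x ⁻¹ * x ≈ 1#
  *-inverseˡ x≉0 = trans (*-comm _ _) (*-inverseʳ x≉0)

  ⁻¹-unique : ∀ {x u} → NonZero x → x * u ≈ 1# → u ≈ x ⁻¹
  ⁻¹-unique {x} {u} x≉0 xu≈1 = begin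
    u               ≈⟨ sym (*-identityʳ u) ⟩
    u * 1#          ≈⟨ *-congˡ (sym (*-inverseʳ x≉0)) ⟩
    u * (x * x ⁻¹)  ≈⟨ sym (*-assoc u x (x ⁻¹)) ⟩
    (u * x) * x ⁻¹  ≈⟨ *-congʳ (trans (*-comm u x) xu≈1) ⟩
    1# * x ⁻¹       ≈⟨ *-identityˡ _ ⟩
    x ⁻¹            ∎

  ⁻¹-nonZero : ∀ {x} → NonZero x → NonZero (x ⁻¹)
  ⁻¹-nonZero {x} x≉0 x⁻¹≈0 = 0≉1 (begin
    0#        ≈⟨ sym (zeroʳ x) ⟩
    x * 0#    ≈⟨ *-congˡ (sym x⁻¹≈0) ⟩
    x * x ⁻¹  ≈⟨ *-inverseʳ x≉0 ⟩
    1#        ∎)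

  *-nonZero : ∀ {x y} → NonZero x → NonZero y → NonZero (x * y)
  *-nonZero {x} {y} x≉0 y≉0 xy≈0 = y≉0 (begin
    y               ≈⟨ sym (*-identityˡ y) ⟩
    1# * y          ≈⟨ *-congʳ (sym (*-inverseˡ x≉0)) ⟩
    (x ⁻¹ * x) * y  ≈⟨ *-assoc _ _ _ ⟩
    x ⁻¹ * (x * y)  ≈⟨ *-congˡ xy≈0 ⟩
    x ⁻¹ * 0#       ≈⟨ zeroʳ _ ⟩
    0#              ∎)

  ⁻¹-cong : ∀ {x y} → NonZero x → x ≈ y → x ⁻¹ ≈ y ⁻¹
  ⁻¹-cong x≉0 x≈y = ⁻¹-unique (nonZero-cong x≈y x≉0) (trans (*-congʳ (sym x≈y)) (*-inverseʳ x≉0))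

  ⁻¹-distrib-* : ∀ {x y} → NonZero x → NonZero y → (x * y) ⁻¹ ≈ x ⁻¹ * y ⁻¹
  ⁻¹-distrib-* {x} {y} x≉0 y≉0 = sym (⁻¹-unique (*-nonZero x≉0 y≉0) (begin
    (x * y) * (x ⁻¹ * y ⁻¹)    ≈⟨ interchange x y (x ⁻¹) (y ⁻¹) ⟩
    (x * x ⁻¹) * (y * y ⁻¹)    ≈⟨ *-cong (*-inverseʳ x≉0) (*-inverseʳ y≉0) ⟩
    1# * 1#                    ≈⟨ *-identityˡ 1# ⟩
    1#                         ∎))

  /-cross : ∀ {a b c d} → NonZero b → NonZero d → a * d ≈ c * b → a / b ≈ c / d
  /-cross {a} {b} {c} {d} b≉0 d≉0 ad≈cb = begin
    a * b ⁻¹                      ≈⟨ sym (*-identityʳ _) ⟩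
    (a * b ⁻¹) * 1#               ≈⟨ *-congˡ (sym (*-inverseʳ d≉0)) ⟩
    (a * b ⁻¹) * (d * d ⁻¹)       ≈⟨ interchange a (b ⁻¹) d (d ⁻¹) ⟩
    (a * d) * (b ⁻¹ * d ⁻¹)       ≈⟨ *-congʳ ad≈cb ⟩
    (c * b) * (b ⁻¹ * d ⁻¹)       ≈⟨ solve 4 (λ c b b′ d′ → (c :* b) :* (b′ :* d′) := (c :* d′) :* (b :* b′))
                                             refl c b (b ⁻¹) (d ⁻¹) ⟩
    (c * d ⁻¹) * (b * b ⁻¹)       ≈⟨ *-congˡ (*-inverseʳ b≉0) ⟩
    (c * d ⁻¹) * 1#               ≈⟨ *-identityʳ _ ⟩
    c * d ⁻¹                      ∎

  /-+-/ : ∀ {a b c d} → NonZero b → NonZero d → a / b + c / d ≈ (a * d + c * b) / (b * d)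
  /-+-/ {a} {b} {c} {d} b≉0 d≉0 = sym (begin
    (a * d + c * b) * (b * d) ⁻¹                       ≈⟨ *-congˡ (⁻¹-distrib-* b≉0 d≉0) ⟩
    (a * d + c * b) * (b ⁻¹ * d ⁻¹)                    ≈⟨ expand ⟩
    a * b ⁻¹ * (d * d ⁻¹) + c * d ⁻¹ * (b * b ⁻¹)      ≈⟨ +-cong (*-congˡ (*-inverseʳ d≉0)) (*-congˡ (*-inverseʳ b≉0)) ⟩
    a * b ⁻¹ * 1# + c * d ⁻¹ * 1#                      ≈⟨ +-cong (*-identityʳ _) (*-identityʳ _) ⟩
    a * b ⁻¹ + c * d ⁻¹                                ∎)
    where
    expand = solve 6 (λ a b c d b′ d′ → (a :* d :+ c :* b) :* (b′ :* d′) := a :* b′ :* (d :* d′) :+ c :* d′ :* (b :* b′))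
                     refl a b c d (b ⁻¹) (d ⁻¹)

  /-*-/ : ∀ {a b c d} → NonZero b → NonZero d → (a / b) * (c / d) ≈ (a * c) / (b * d)
  /-*-/ {a} {b} {c} {d} b≉0 d≉0 = sym (begin
    (a * c) * (b * d) ⁻¹         ≈⟨ *-congˡ (⁻¹-distrib-* b≉0 d≉0) ⟩
    (a * c) * (b ⁻¹ * d ⁻¹)      ≈⟨ interchange a c (b ⁻¹) (d ⁻¹) ⟩
    (a * b ⁻¹) * (c * d ⁻¹)      ∎)

  prodFrom-nonZero : ∀ (a : ℕ → Carrier) n m → (∀ i → i < n ℕ.+ m → NonZero (a i)) → NonZero (prodFrom a n m)
  prodFrom-nonZero a zero    m _   = 1≉0
  prodFrom-nonZero a (suc n) m a≉0 = *-nonZero (a≉0 m (s≤s (ℕₚ.m≤n+m m n)))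
                                               (prodFrom-nonZero a n (suc m) λ i i<n+1+m →
                                                  a≉0 i (≡.subst (i <_) (ℕₚ.+-suc n m) i<n+1+m))

  horizontalRatio verticalRatio : (x y : ℕ → Carrier) → ℕ → Carrier
  horizontalRatio x y m = (x m * y (suc m)) / (y m * x (suc m))
  verticalRatio   x y m = (x m * y (suc (suc m))) / (x (suc m) * y (suc m))

  module _ {x x′ : ℕ → Carrier} (y : ℕ → Carrier) (x≈x′ : ∀ i → x i ≈ x′ i)
           (x≉0 : ∀ i → NonZero (x i)) (y≉0 : ∀ i → NonZero (y i)) where

    horizontalRatio-congˡ : ∀ m → horizontalRatio x y m ≈ horizontalRatio x′ y m
    horizontalRatio-congˡ m =
      *-cong (*-congʳ (x≈x′ m)) (⁻¹-cong (*-nonZero (y≉0 m) (x≉0 (suc m))) (*-congˡ (x≈x′ (suc m))))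

    verticalRatio-congˡ : ∀ m → verticalRatio x y m ≈ verticalRatio x′ y m
    verticalRatio-congˡ m =
      *-cong (*-congʳ (x≈x′ m)) (⁻¹-cong (*-nonZero (x≉0 (suc m)) (y≉0 (suc m))) (*-congʳ (x≈x′ (suc m))))

module Continuants {c ℓ} (R : CommutativeRing c ℓ) where
  open CommutativeRing R hiding (zero)
  open Sums R using (prodFrom)
  open SetoidReasoning setoid
  open NatSolver commutativeSemiring

  δ₀ : ℤ → Carrier
  δ₀ τ = if ⌊ + 0 ℤ.≟ τ ⌋ then 1# else 0#

  -- continuant a b e n m τ is the coefficient of z^τ in P n m, where P 0 m = 1,
  -- P 1 m = a m + b m z⁻¹ and P (n + 2) m = (a m + b m z⁻¹) P (n + 1) (m + 1) + e m z⁻¹ P n (m + 2).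
  continuant : (a b e : ℕ → Carrier) → ℕ → ℕ → ℤ → Carrier
  continuant a b e zero          m τ = δ₀ τ
  continuant a b e (suc zero)    m τ = a m * δ₀ τ + b m * δ₀ (τ ℤ.+ + 1)
  continuant a b e (suc (suc n)) m τ =
    a m * continuant a b e (suc n) (suc m) τ + b m * continuant a b e (suc n) (suc m) (τ ℤ.+ + 1)
    + e m * continuant a b e n (suc (suc m)) (τ ℤ.+ + 1)

  continuant-cong : ∀ {a b e a′ b′ e′ : ℕ → Carrier} →
    (∀ i → a i ≈ a′ i) → (∀ i → b i ≈ b′ i) → (∀ i → e i ≈ e′ i) →
    ∀ n m τ → continuant a b e n m τ ≈ continuant a′ b′ e′ n m τ
  continuant-cong a≈ b≈ e≈ zero          m τ = refl
  continuant-cong a≈ b≈ e≈ (suc zero)    m τ = +-cong (*-congʳ (a≈ m)) (*-congʳ (b≈ m))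
  continuant-cong a≈ b≈ e≈ (suc (suc n)) m τ =
    +-cong (+-cong (*-cong (a≈ m) (continuant-cong a≈ b≈ e≈ (suc n) (suc m) τ))
                   (*-cong (b≈ m) (continuant-cong a≈ b≈ e≈ (suc n) (suc m) _)))
           (*-cong (e≈ m) (continuant-cong a≈ b≈ e≈ n (suc (suc m)) _))

  1s : ℕ → Carrier
  1s _ = 1#

  continuant-rescale : ∀ (a b e t d : ℕ → Carrier) r →
    (∀ m → m ≤ r → a m * t m ≈ b m) → (∀ m → m < r → (a m * a (suc m)) * d m ≈ e m) →
    ∀ n m τ → n ℕ.+ m ≤ suc r → continuant a b e n m τ ≈ prodFrom a n m * continuant 1s t d n m τ
  continuant-rescale a b e t d r at≈b aad≈e = rescale
    where
    rescale : ∀ n m τ → n ℕ.+ m ≤ suc r → continuant a b e n m τ ≈ prodFrom a n m * continuant 1s t d n m τ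
    rescale zero          m τ _         = sym (*-identityˡ _)
    rescale (suc zero)    m τ (s≤s m≤r) = begin
      a m * δ₀ τ + b m * δ₀ τ₁                  ≈⟨ +-congˡ (*-congʳ (sym (at≈b m m≤r))) ⟩
      a m * δ₀ τ + (a m * t m) * δ₀ τ₁
        ≈⟨ solve 4 (λ x y u v → x :* u :+ (x :* y) :* v := (x :* con 1) :* (con 1 :* u :+ y :* v)) refl (a m) (t m) (δ₀ τ) (δ₀ τ₁) ⟩
      (a m * 1#) * (1# * δ₀ τ + t m * δ₀ τ₁)    ∎
      where τ₁ = τ ℤ.+ + 1
    rescale (suc (suc n)) m τ (s≤s le) = begin
      a m * L₁ + b m * L₁′ + e m * L₂
        ≈⟨ +-cong (+-cong (*-congˡ (rescale (suc n) (suc m) τ le₁))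
                          (*-cong (sym (at≈b m m≤r)) (rescale (suc n) (suc m) τ₁ le₁)))
                  (*-cong (sym (aad≈e m m<r)) (rescale n (suc (suc m)) τ₁ le₂)) ⟩
      a m * (a (suc m) * P * N₁) + (a m * t m) * (a (suc m) * P * N₁′) + ((a m * a (suc m)) * d m) * (P * N₂)
        ≈⟨ solve 8 (λ x y p z₁ z₁′ z₂ u v → x :* (y :* p :* z₁) :+ (x :* u) :* (y :* p :* z₁′) :+ ((x :* y) :* v) :* (p :* z₂)
                                           := (x :* (y :* p)) :* (con 1 :* z₁ :+ u :* z₁′ :+ v :* z₂))
                   refl (a m) (a (suc m)) P N₁ N₁′ N₂ (t m) (d m) ⟩
      (a m * (a (suc m) * P)) * (1# * N₁ + t m * N₁′ + d m * N₂) ∎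
      where
      τ₁ = τ ℤ.+ + 1
      L₁ = continuant a b e (suc n) (suc m) τ
      L₁′ = continuant a b e (suc n) (suc m) τ₁
      L₂ = continuant a b e n (suc (suc m)) τ₁
      P = prodFrom a n (suc (suc m))
      N₁ = continuant 1s t d (suc n) (suc m) τ
      N₁′ = continuant 1s t d (suc n) (suc m) τ₁
      N₂ = continuant 1s t d n (suc (suc m)) τ₁
      le₁ : suc n ℕ.+ suc m ≤ suc r
      le₁ = ≡.subst (_≤ suc r) (≡.sym (ℕₚ.+-suc (suc n) m)) (s≤s le)
      le₂ : n ℕ.+ suc (suc m) ≤ suc r
      le₂ = ≡.subst (_≤ suc r) (≡.sym (≡.trans (ℕₚ.+-suc n (suc m)) (≡.cong suc (ℕₚ.+-suc n m)))) (s≤s le)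
      m<r : m < r
      m<r = ℕₚ.≤-trans (s≤s (ℕₚ.m≤n+m m n)) le
      m≤r : m ≤ r
      m≤r = ℕₚ.<⇒≤ m<r

  continuant-refactor : ∀ (t d t′ D : ℕ → Carrier) r →
    (∀ m → m < r → t′ m + D m ≈ t m + d m) → t′ r + D r ≈ t r →
    (∀ m → m < r → D (suc m) * t m ≈ d m * t′ (suc m)) → D 0 ≈ 0# →
    ∀ τ → continuant 1s t d (suc r) 0 τ ≈ continuant 1s t′ (D ∘ suc) (suc r) 0 τ
  continuant-refactor t d t′ D r sum-rel sum-rel-top product-rel D₀≈0 τ = begin
    K (suc r) 0 τ                              ≈⟨ split r 0 (≡.cong suc (ℕₚ.+-identityʳ r)) τ ⟩
    K′ (suc r) 0 τ + D 0 * K′ r 1 (τ ℤ.+ + 1)  ≈⟨ +-congˡ (trans (*-congʳ D₀≈0) (zeroˡ _)) ⟩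
    K′ (suc r) 0 τ + 0#                        ≈⟨ +-identityʳ _ ⟩
    K′ (suc r) 0 τ                             ∎
    where
    K K′ : ℕ → ℕ → ℤ → Carrier
    K  = continuant 1s t d
    K′ = continuant 1s t′ (D ∘ suc)

    split : ∀ n m → suc n ℕ.+ m ≡ suc r → ∀ τ → K (suc n) m τ ≈ K′ (suc n) m τ + D m * K′ n (suc m) (τ ℤ.+ + 1)
    split zero m eq τ with ℕₚ.suc-injective eq
    ... | ≡.refl = begin
      1# * δ₀ τ + t r * δ₀ τ₁                        ≈⟨ +-congˡ (*-congʳ (sym sum-rel-top)) ⟩
      1# * δ₀ τ + (t′ r + D r) * δ₀ τ₁
        ≈⟨ solve 4 (λ a b c d → con 1 :* a :+ (b :+ c) :* d := (con 1 :* a :+ b :* d) :+ c :* d) refl (δ₀ τ) (t′ r) (D r) (δ₀ τ₁) ⟩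
      (1# * δ₀ τ + t′ r * δ₀ τ₁) + D r * δ₀ τ₁       ∎
      where τ₁ = τ ℤ.+ + 1
    split (suc n) m eq τ = begin
      1# * K (suc n) (suc m) τ + t m * K (suc n) (suc m) τ₁ + d m * K n (suc (suc m)) τ₁
        ≈⟨ +-cong (+-cong (*-congˡ (split n (suc m) eq′ τ)) (*-congˡ (split n (suc m) eq′ τ₁))) (*-congˡ (split-below n eq)) ⟩
      1# * (u + D₁ * v₁) + t m * (u₁ + D₁ * v₂) + d m * (v₁ + D₂ * rest n)
        ≈⟨ solve 9 (λ u u₁ v₁ v₂ w D₁ D₂ t d → con 1 :* (u :+ D₁ :* v₁) :+ t :* (u₁ :+ D₁ :* v₂) :+ d :* (v₁ :+ D₂ :* w)
                                             := u :+ D₁ :* v₁ :+ t :* u₁ :+ (D₁ :* t) :* v₂ :+ d :* (v₁ :+ D₂ :* w))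
                   refl u u₁ v₁ v₂ (rest n) D₁ D₂ (t m) (d m) ⟩
      u + D₁ * v₁ + t m * u₁ + (D₁ * t m) * v₂ + d m * (v₁ + D₂ * rest n)
        ≈⟨ +-congʳ (+-congˡ (*-congʳ (product-rel m m<r))) ⟩
      u + D₁ * v₁ + t m * u₁ + (d m * t′ (suc m)) * v₂ + d m * (v₁ + D₂ * rest n)
        ≈⟨ solve 10 (λ u u₁ v₁ v₂ w D₁ D₂ t d t₁ → u :+ D₁ :* v₁ :+ t :* u₁ :+ (d :* t₁) :* v₂ :+ d :* (v₁ :+ D₂ :* w)
                                                := u :+ D₁ :* v₁ :+ t :* u₁ :+ d :* (con 1 :* v₁ :+ t₁ :* v₂ :+ D₂ :* w))
                   refl u u₁ v₁ v₂ (rest n) D₁ D₂ (t m) (d m) (t′ (suc m)) ⟩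
      u + D₁ * v₁ + t m * u₁ + d m * (1# * v₁ + t′ (suc m) * v₂ + D₂ * rest n)
        ≈⟨ +-congˡ (*-congˡ (sym (unfold n))) ⟩
      u + D₁ * v₁ + t m * u₁ + d m * u₁
        ≈⟨ trans (+-assoc _ _ _) (+-congˡ (sym (distribʳ u₁ (t m) (d m)))) ⟩
      u + D₁ * v₁ + (t m + d m) * u₁
        ≈⟨ +-congˡ (*-congʳ (sym (sum-rel m m<r))) ⟩
      u + D₁ * v₁ + (t′ m + D m) * u₁
        ≈⟨ solve 6 (λ u u₁ v₁ D₁ t′ D → u :+ D₁ :* v₁ :+ (t′ :+ D) :* u₁ := (con 1 :* u :+ t′ :* u₁ :+ D₁ :* v₁) :+ D :* u₁)
                   refl u u₁ v₁ D₁ (t′ m) (D m) ⟩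
      (1# * u + t′ m * u₁ + D₁ * v₁) + D m * u₁
        ∎
      where
      τ₁ = τ ℤ.+ + 1
      τ₂ = τ₁ ℤ.+ + 1
      D₁ = D (suc m)
      D₂ = D (suc (suc m))
      u  = K′ (suc n) (suc m) τ
      u₁ = K′ (suc n) (suc m) τ₁
      v₁ = K′ n (suc (suc m)) τ₁
      v₂ = K′ n (suc (suc m)) τ₂
      eq′ : suc n ℕ.+ suc m ≡ suc r
      eq′ = ≡.trans (ℕₚ.+-suc (suc n) m) eq
      m<r : m < r
      m<r = ≡.subst (suc m ≤_) (ℕₚ.suc-injective eq) (s≤s (ℕₚ.m≤n+m m n))
      rest : ℕ → Carrier
      rest zero     = 0#
      rest (suc n′) = K′ n′ (suc (suc (suc m))) τ₂
      unfold : ∀ n → K′ (suc n) (suc m) τ₁ ≈ 1# * K′ n (suc (suc m)) τ₁ + t′ (suc m) * K′ n (suc (suc m)) τ₂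
                                            + D₂ * rest n
      unfold zero     = sym (trans (+-congˡ (zeroʳ _)) (+-identityʳ _))
      unfold (suc n′) = refl
      split-below : ∀ n → suc (suc n) ℕ.+ m ≡ suc r → K n (suc (suc m)) τ₁ ≈ K′ n (suc (suc m)) τ₁ + D₂ * rest n
      split-below zero     _  = sym (trans (+-congˡ (zeroʳ _)) (+-identityʳ _))
      split-below (suc n′) e =
        split n′ (suc (suc m)) (≡.trans (ℕₚ.+-suc (suc n′) (suc m)) (≡.trans (ℕₚ.+-suc (suc (suc n′)) m) e)) τ₁

atℕ-toℕ : ∀ {A : Set} {n} (f : Fin n → A) d (i : Fin n) → atℕ f d (toℕ i) ≡ f i
atℕ-toℕ f d Fin.zero    = ≡.refl
atℕ-toℕ f d (Fin.suc i) = atℕ-toℕ (f ∘ Fin.suc) d i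

atℕ-beyond : ∀ {A : Set} n (f : Fin n → A) d → atℕ f d n ≡ d
atℕ-beyond zero    f d = ≡.refl
atℕ-beyond (suc n) f d = atℕ-beyond n (f ∘ Fin.suc) d

atℕ-const : ∀ {A : Set} n (x : A) i → atℕ {n = n} (λ _ → x) x i ≡ x
atℕ-const zero    x i       = ≡.refl
atℕ-const (suc n) x zero    = ≡.refl
atℕ-const (suc n) x (suc i) = atℕ-const n x i

allB-∧ : ∀ {A : Set} (p q : A → Bool) xs → allB p xs ∧ (allB q xs ∧ true) ≡ and (map (λ a → p a ∧ (q a ∧ true)) xs)
allB-∧ p q []       = ≡.refl
allB-∧ p q (x ∷ xs) with p x | q x
... | false | _     = ≡.refl
... | true  | false = Boolₚ.∧-zeroʳ (allB p xs)
... | true  | true  = allB-∧ p q xs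

∧-guard-swap : ∀ a b {c d} → (a ≡ true → c ≡ d) → a ∧ b ∧ c ≡ d ∧ (a ∧ b)
∧-guard-swap true  b {d = d} c≡d = ≡.trans (≡.cong (b ∧_) (c≡d ≡.refl)) (Boolₚ.∧-comm b d)
∧-guard-swap false b {d = d} _   = ≡.sym (Boolₚ.∧-zeroʳ d)

T⇒≡true : ∀ {b} → T b → b ≡ true
T⇒≡true = Equivalence.to Boolₚ.T-≡

¬T⇒≡false : ∀ {b} → ¬ T b → b ≡ false
¬T⇒≡false {true}  ¬t = ⊥-elim (¬t tt)
¬T⇒≡false {false} _  = ≡.refl

⌊+≟⌋≡⌊≟-⌋ : ∀ a b τ → ⌊ a ℤ.+ b ℤ.≟ τ ⌋ ≡ ⌊ b ℤ.≟ τ ℤ.- a ⌋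
⌊+≟⌋≡⌊≟-⌋ a b τ with a ℤ.+ b ℤ.≟ τ | b ℤ.≟ τ ℤ.- a
... | yes _   | yes _   = ≡.refl
... | no  _   | no  _   = ≡.refl
... | yes a+b≡τ | no b≢τ-a = ⊥-elim (b≢τ-a (≡.trans (cancel a b) (≡.cong (ℤ._- a) a+b≡τ)))
  where cancel : ∀ a b → b ≡ a ℤ.+ b ℤ.- a
        cancel = ℤ-Solver.solve-∀
... | no a+b≢τ | yes b≡τ-a = ⊥-elim (a+b≢τ (≡.trans (≡.cong (λ x → a ℤ.+ x) b≡τ-a) (cancel a τ)))
  where cancel : ∀ a τ → a ℤ.+ (τ ℤ.- a) ≡ τ
        cancel = ℤ-Solver.solve-∀

module Rows where

  col₀ col₁ : Fin 2
  col₀ = Fin.zero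
  col₁ = Fin.suc Fin.zero

  -- A pair rather than a function on Fin 2, so that rows with equal entries are definitionally equal.
  Row : Set
  Row = Bool × Bool

  rowOf : (Fin 2 → Bool) → Row
  rowOf f = f col₀ , f col₁

  none both : Row
  none = false , false
  both = true , true

  rows : List Row
  rows = (false , false) ∷ (false , true) ∷ (true , false) ∷ (true , true) ∷ []

  admissible : (horizontal upward downward : Row) → Bool
  admissible h v p = (χ (proj₁ h) ℕ.+ χ (proj₂ h) ℕ.+ χ (proj₁ v) ℕ.+ χ (proj₁ p) ≡ᵇ 1)
                   ∧ ((χ (proj₁ h) ℕ.+ χ (proj₂ h) ℕ.+ χ (proj₂ v) ℕ.+ χ (proj₂ p) ≡ᵇ 1) ∧ true)

  admissible-none⇒balanced : ∀ h v → admissible h v none ≡ true → proj₁ v ≡ proj₂ v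
  admissible-none⇒balanced _              (false , false) _  = ≡.refl
  admissible-none⇒balanced _              (true  , true)  _  = ≡.refl
  admissible-none⇒balanced (false , false) (false , true) ()
  admissible-none⇒balanced (false , true)  (false , true) ()
  admissible-none⇒balanced (true  , false) (false , true) ()
  admissible-none⇒balanced (true  , true)  (false , true) ()
  admissible-none⇒balanced (false , false) (true , false) ()
  admissible-none⇒balanced (false , true)  (true , false) ()
  admissible-none⇒balanced (true  , false) (true , false) ()
  admissible-none⇒balanced (true  , true)  (true , false) ()

  rowWinding : Row → ℕ → ℤ
  rowWinding h i = sgn (black col₀ i) ℤ.* (χℤ (proj₁ h) ℤ.- χℤ (black col₀ i))

  referenceRow otherRow : ℕ → Row
  referenceRow i = black col₀ i , black col₁ i
  otherRow     i = black col₁ i , black col₀ i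

  rowWinding-reference : ∀ i → rowWinding (referenceRow i) i ≡ + 0
  rowWinding-reference i = vanish (odd i)
    where
    vanish : ∀ p → sgn p ℤ.* (χℤ p ℤ.- χℤ p) ≡ + 0
    vanish true  = ≡.refl
    vanish false = ≡.refl

  rowWinding-other : ∀ i → rowWinding (otherRow i) i ≡ ℤ.-[1+ 0 ]
  rowWinding-other i = minusOne (odd i)
    where
    minusOne : ∀ p → sgn p ℤ.* (χℤ (not p) ℤ.- χℤ p) ≡ ℤ.-[1+ 0 ]
    minusOne true  = ≡.refl
    minusOne false = ≡.refl

  rowWinding-none-consecutive : ∀ i τ → τ ℤ.- rowWinding none i ℤ.- rowWinding none (suc i) ≡ τ ℤ.+ + 1
  rowWinding-none-consecutive i τ = shift (odd i)
    where
    shift : ∀ p → τ ℤ.- sgn p ℤ.* (χℤ false ℤ.- χℤ p) ℤ.- sgn (not p) ℤ.* (χℤ false ℤ.- χℤ (not p)) ≡ τ ℤ.+ + 1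
    shift true  = ℤₚ.+-identityʳ (τ ℤ.+ + 1)
    shift false = ≡.cong (ℤ._+ + 1) (ℤₚ.+-identityʳ τ)

  horRows : ∀ {n} → (Fin n → Fin 2 → Bool) → ℕ → Row
  horRows hf i = rowOf (atℕ hf (λ _ → false) i)

  verRows : ∀ {n} → (Fin n → Fin 2 → Bool) → ℕ → Row
  verRows vf i = rowOf (λ x → atℕ (λ j → vf j x) false i)

  below : Row → (ℕ → Row) → ℕ → Row
  below p vs zero    = p
  below p vs (suc i) = vs i

module Dimers (F : Field 0ℓ 0ℓ) (r : ℕ) (A : ℕ → Field.Carrier F) where
  open Field F hiding (zero)
  open Hamiltonian F using (edgeWeight; weight; H)
  open Sums commutativeRing
  open Continuants commutativeRing using (δ₀; continuant)
  open SetoidReasoning setoid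
  open NatSolver commutativeSemiring
  open Rows

  pairWeight : (Fin 2 → ℕ → ℕ × ℕ) → Row → ℕ → Carrier
  pairWeight faces e i = (if proj₁ e then edgeWeight A (faces col₀ i) else 1#)
                       * ((if proj₂ e then edgeWeight A (faces col₁ i) else 1#) * 1#)

  rowWeight : (horizontal upward : Row) → ℕ → Carrier
  rowWeight h v i = pairWeight (horFaces r) h i * pairWeight (verFaces r) v i

  stripWeight : ℕ → (hs vs : ℕ → Row) → (downward : Row) → ℕ → ℤ → Carrier
  stripWeight zero    hs vs p m τ = δ₀ τ
  stripWeight (suc n) hs vs p m τ =
    when (admissible (hs 0) (vs 0) p)
         (rowWeight (hs 0) (vs 0) m * stripWeight n (hs ∘ suc) (vs ∘ suc) (vs 0) (suc m) (τ ℤ.- rowWinding (hs 0) m))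

  stripWeight-closedForm : ∀ n hs vs p m τ →
    when (and (tabulate {n = n} λ y → admissible (hs (toℕ y)) (vs (toℕ y)) (below p vs (toℕ y)))
          ∧ ⌊ sumℤ (tabulate {n = n} λ y → rowWinding (hs (toℕ y)) (toℕ y ℕ.+ m)) ℤ.≟ τ ⌋)
         (∏ (tabulate {n = n} λ y → rowWeight (hs (toℕ y)) (vs (toℕ y)) (toℕ y ℕ.+ m)))
    ≈ stripWeight n hs vs p m τ
  stripWeight-closedForm zero    hs vs p m τ = refl
  stripWeight-closedForm (suc n) hs vs p m τ with admissible (hs 0) (vs 0) p
  ... | false = refl
  ... | true  = begin
    when (and oks ∧ ⌊ w₀ ℤ.+ sumℤ winds ℤ.≟ τ ⌋) (ρ₀ * ∏ weights)
      ≡⟨ ≡.cong (λ b → when (and oks ∧ b) (ρ₀ * ∏ weights)) (⌊+≟⌋≡⌊≟-⌋ w₀ (sumℤ winds) τ) ⟩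
    when (and oks ∧ ⌊ sumℤ winds ℤ.≟ τ′ ⌋) (ρ₀ * ∏ weights)
      ≈⟨ sym (when-*ˡ (and oks ∧ ⌊ sumℤ winds ℤ.≟ τ′ ⌋) ρ₀ (∏ weights)) ⟩
    ρ₀ * when (and oks ∧ ⌊ sumℤ winds ℤ.≟ τ′ ⌋) (∏ weights)
      ≡⟨ ≡.cong (λ rest → ρ₀ * rest) shifted ⟩
    ρ₀ * when (and oks′ ∧ ⌊ sumℤ winds′ ℤ.≟ τ′ ⌋) (∏ weights′)
      ≈⟨ *-congˡ (stripWeight-closedForm n (hs ∘ suc) (vs ∘ suc) (vs 0) (suc m) τ′) ⟩
    ρ₀ * stripWeight n (hs ∘ suc) (vs ∘ suc) (vs 0) (suc m) τ′ ∎
    where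
    w₀ = rowWinding (hs 0) m
    ρ₀ = rowWeight (hs 0) (vs 0) m
    τ′ = τ ℤ.- w₀
    oks = tabulate {n = n} λ y → admissible (hs (suc (toℕ y))) (vs (suc (toℕ y))) (vs (toℕ y))
    winds = tabulate {n = n} λ y → rowWinding (hs (suc (toℕ y))) (suc (toℕ y) ℕ.+ m)
    weights = tabulate {n = n} λ y → rowWeight (hs (suc (toℕ y))) (vs (suc (toℕ y))) (suc (toℕ y) ℕ.+ m)
    oks′ = tabulate {n = n} λ y → admissible (hs (suc (toℕ y))) (vs (suc (toℕ y))) (below (vs 0) (vs ∘ suc) (toℕ y))
    winds′ = tabulate {n = n} λ y → rowWinding (hs (suc (toℕ y))) (toℕ y ℕ.+ suc m)
    weights′ = tabulate {n = n} λ y → rowWeight (hs (suc (toℕ y))) (vs (suc (toℕ y))) (toℕ y ℕ.+ suc m)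
    below-shift : ∀ i → vs i ≡ below (vs 0) (vs ∘ suc) i
    below-shift zero    = ≡.refl
    below-shift (suc i) = ≡.refl
    shifted : when (and oks ∧ ⌊ sumℤ winds ℤ.≟ τ′ ⌋) (∏ weights)
            ≡ when (and oks′ ∧ ⌊ sumℤ winds′ ℤ.≟ τ′ ⌋) (∏ weights′)
    shifted = ≡.trans
      (≡.cong (λ o → when (and o ∧ ⌊ sumℤ winds ℤ.≟ τ′ ⌋) (∏ weights))
              (Listₚ.tabulate-cong {n = n} λ y → ≡.cong (admissible (hs (suc (toℕ y))) (vs (suc (toℕ y)))) (below-shift (toℕ y))))
      (≡.cong₂ (λ w ρ → when (and oks′ ∧ ⌊ sumℤ w ℤ.≟ τ′ ⌋) (∏ ρ))
               (Listₚ.tabulate-cong {n = n} λ y → ≡.cong (rowWinding (hs (suc (toℕ y)))) (≡.sym (ℕₚ.+-suc (toℕ y) m)))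
               (Listₚ.tabulate-cong {n = n} λ y →
                 ≡.cong (rowWeight (hs (suc (toℕ y))) (vs (suc (toℕ y)))) (≡.sym (ℕₚ.+-suc (toℕ y) m))))

  transfer : ℕ → (downward : Row) → ℕ → ℤ → Carrier
  transfer zero    p m τ = ∑ rows λ h → when (admissible h none p) (rowWeight h none m * δ₀ (τ ℤ.- rowWinding h m))
  transfer (suc n) p m τ = ∑ rows λ h → ∑ rows λ v →
    when (admissible h v p) (rowWeight h v m * transfer n v (suc m) (τ ℤ.- rowWinding h m))

  rowPatterns : List (Fin 2 → Bool)
  rowPatterns = allFuns 2 bools

  ∑-stripWeight : ∀ n p m τ →
    ∑ (allFuns (suc n) rowPatterns) (λ hf → ∑ (allFuns n rowPatterns) λ vf → stripWeight (suc n) (horRows hf) (verRows vf) p m τ)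
    ≈ transfer n p m τ
  ∑-stripWeight zero p m τ =
    trans (∑-allFuns 0 rowPatterns λ hf → ∑ (allFuns 0 rowPatterns) λ vf → stripWeight 1 (horRows hf) (verRows vf) p m τ)
          (∑-cong {g = top ∘ rowOf} rowPatterns λ _ → trans (+-identityʳ _) (+-identityʳ _))
    where
    top : Row → Carrier
    top h = when (admissible h none p) (rowWeight h none m * δ₀ (τ ℤ.- rowWinding h m))
  ∑-stripWeight (suc n) p m τ = begin
    ∑ (allFuns (suc (suc n)) rowPatterns) (λ hf → ∑ (allFuns (suc n) rowPatterns) λ vf → whole hf vf)
      ≈⟨ ∑-allFuns (suc n) rowPatterns (λ hf → ∑ (allFuns (suc n) rowPatterns) λ vf → whole hf vf) ⟩
    ∑ rowPatterns (λ b → ∑ hfs λ hf → ∑ (allFuns (suc n) rowPatterns) λ vf → whole (b Vector.∷ hf) vf)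
      ≈⟨ ∑-cong rowPatterns (λ b → ∑-cong hfs λ hf → ∑-allFuns n rowPatterns (whole (b Vector.∷ hf))) ⟩
    ∑ rowPatterns (λ b → ∑ hfs λ hf → ∑ rowPatterns λ v → ∑ vfs λ vf → whole (b Vector.∷ hf) (v Vector.∷ vf))
      ≈⟨ ∑-cong rowPatterns (λ b →
           ∑-comm (λ hf v → ∑ vfs λ vf → whole (b Vector.∷ hf) (v Vector.∷ vf)) hfs rowPatterns) ⟩
    ∑ rowPatterns (λ b → ∑ rowPatterns λ v → ∑ hfs λ hf → ∑ vfs λ vf → whole (b Vector.∷ hf) (v Vector.∷ vf))
      ≈⟨ ∑-cong rowPatterns (λ b → ∑-cong rowPatterns λ v → factorOut (rowOf b) (rowOf v)) ⟩
    transfer (suc n) p m τ ∎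
    where
    hfs = allFuns (suc n) rowPatterns
    vfs = allFuns n rowPatterns
    whole : (Fin (suc (suc n)) → Fin 2 → Bool) → (Fin (suc n) → Fin 2 → Bool) → Carrier
    whole hf vf = stripWeight (suc (suc n)) (horRows hf) (verRows vf) p m τ
    factorOut : ∀ h v →
      ∑ hfs (λ hf → ∑ vfs λ vf →
        when (admissible h v p) (rowWeight h v m * stripWeight (suc n) (horRows hf) (verRows vf) v (suc m) (τ ℤ.- rowWinding h m)))
      ≈ when (admissible h v p) (rowWeight h v m * transfer n v (suc m) (τ ℤ.- rowWinding h m))
    factorOut h v = begin
      ∑ hfs (λ hf → ∑ vfs λ vf → when ok (ρ * rest hf vf))
        ≈⟨ ∑-cong hfs (λ hf → ∑-when ok _ vfs) ⟩
      ∑ hfs (λ hf → when ok (∑ vfs λ vf → ρ * rest hf vf))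
        ≈⟨ ∑-when ok _ hfs ⟩
      when ok (∑ hfs λ hf → ∑ vfs λ vf → ρ * rest hf vf)
        ≈⟨ when-cong ok (trans (∑-cong hfs (λ hf → ∑-*ˡ ρ (rest hf) vfs)) (∑-*ˡ ρ _ hfs)) ⟩
      when ok (ρ * ∑ hfs λ hf → ∑ vfs (rest hf))
        ≈⟨ when-cong ok (*-congˡ (∑-stripWeight n v (suc m) _)) ⟩
      when ok (ρ * transfer n v (suc m) (τ ℤ.- rowWinding h m)) ∎
      where
      ok = admissible h v p
      ρ = rowWeight h v m
      rest : (Fin (suc n) → Fin 2 → Bool) → (Fin n → Fin 2 → Bool) → Carrier
      rest hf vf = stripWeight (suc n) (horRows hf) (verRows vf) v (suc m) (τ ℤ.- rowWinding h m)

  α β ε : ℕ → Carrier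
  α i = rowWeight (referenceRow i) none i
  β i = rowWeight (otherRow i) none i
  ε i = rowWeight none both i

  ∑-single-edge-rows : ∀ p (f : Row → Carrier) → f (false , true) + f (true , false) ≈ f (p , not p) + f (not p , p)
  ∑-single-edge-rows true  f = +-comm _ _
  ∑-single-edge-rows false f = refl

  transfer-none : ∀ n m τ → transfer n none m τ ≈ continuant α β ε (suc n) m τ
  transfer-both : ∀ n m τ → transfer n both m τ ≈ continuant α β ε n (suc m) (τ ℤ.- rowWinding none m)

  -- Expanding the sums over rows, only the admissible rows survive: from below none either one
  -- horizontal edge or both vertical edges, from below both no edge at all.
  transfer-none zero m τ = begin
    transfer 0 none m τ
      ≈⟨ solve 2 (λ a b → con 0 :+ (a :+ (b :+ (con 0 :+ con 0))) := a :+ b) refl _ _ ⟩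
    f (false , true) + f (true , false)
      ≈⟨ ∑-single-edge-rows (odd m) f ⟩
    f (referenceRow m) + f (otherRow m)
      ≡⟨ ≡.cong₂ (λ a b → α m * δ₀ a + β m * δ₀ (τ ℤ.- b))
                 (≡.trans (≡.cong (λ w → τ ℤ.- w) (rowWinding-reference m)) (ℤₚ.+-identityʳ τ)) (rowWinding-other m) ⟩
    continuant α β ε 1 m τ ∎
    where
    f : Row → Carrier
    f h = rowWeight h none m * δ₀ (τ ℤ.- rowWinding h m)
  transfer-none (suc n) m τ = begin
    transfer (suc n) none m τ
      ≈⟨ solve 3 (λ a b c → (con 0 :+ (con 0 :+ (con 0 :+ (c :+ con 0))))
                           :+ ((a :+ (con 0 :+ (con 0 :+ (con 0 :+ con 0))))
                           :+ ((b :+ (con 0 :+ (con 0 :+ (con 0 :+ con 0))))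
                           :+ ((con 0 :+ (con 0 :+ (con 0 :+ (con 0 :+ con 0)))) :+ con 0)))
                           := a :+ b :+ c) refl _ _ _ ⟩
    g (false , true) + g (true , false) + ε m * transfer n both (suc m) τ₀
      ≈⟨ +-congʳ (∑-single-edge-rows (odd m) g) ⟩
    g (referenceRow m) + g (otherRow m) + ε m * transfer n both (suc m) τ₀
      ≡⟨ ≡.cong₂ (λ a b → α m * transfer n none (suc m) a + β m * transfer n none (suc m) (τ ℤ.- b)
                         + ε m * transfer n both (suc m) τ₀)
                 (≡.trans (≡.cong (λ w → τ ℤ.- w) (rowWinding-reference m)) (ℤₚ.+-identityʳ τ)) (rowWinding-other m) ⟩
    α m * transfer n none (suc m) τ + β m * transfer n none (suc m) (τ ℤ.+ + 1) + ε m * transfer n both (suc m) τ₀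
      ≈⟨ +-cong (+-cong (*-congˡ (transfer-none n (suc m) τ)) (*-congˡ (transfer-none n (suc m) _)))
                (*-congˡ (transfer-both n (suc m) τ₀)) ⟩
    α m * continuant α β ε (suc n) (suc m) τ + β m * continuant α β ε (suc n) (suc m) (τ ℤ.+ + 1)
      + ε m * continuant α β ε n (suc (suc m)) (τ₀ ℤ.- rowWinding none (suc m))
      ≡⟨ ≡.cong (λ a → α m * continuant α β ε (suc n) (suc m) τ + β m * continuant α β ε (suc n) (suc m) (τ ℤ.+ + 1)
                       + ε m * continuant α β ε n (suc (suc m)) a)
                (rowWinding-none-consecutive m τ) ⟩
    continuant α β ε (suc (suc n)) m τ ∎
    where
    τ₀ = τ ℤ.- rowWinding none m
    g : Row → Carrier
    g h = rowWeight h none m * transfer n none (suc m) (τ ℤ.- rowWinding h m)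

  transfer-both zero m τ =
    solve 1 (λ x → ((con 1 :* (con 1 :* con 1)) :* (con 1 :* (con 1 :* con 1))) :* x :+ (con 0 :+ (con 0 :+ (con 0 :+ con 0))) := x) refl _
  transfer-both (suc n) m τ = trans
    (solve 1 (λ x → (((con 1 :* (con 1 :* con 1)) :* (con 1 :* (con 1 :* con 1))) :* x :+ (con 0 :+ (con 0 :+ (con 0 :+ con 0))))
                    :+ ((con 0 :+ (con 0 :+ (con 0 :+ (con 0 :+ con 0)))) :+ ((con 0 :+ (con 0 :+ (con 0 :+ (con 0 :+ con 0))))
                    :+ ((con 0 :+ (con 0 :+ (con 0 :+ (con 0 :+ con 0)))) :+ con 0))) := x) refl _)
    (transfer-none n (suc m) (τ ℤ.- rowWinding none m))

  module _ (hf : Fin (suc r) → Fin 2 → Bool) (vf : Fin r → Fin 2 → Bool) where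
    private
      M : EdgeSet r
      M = edgeSet hf vf
      hs vs : ℕ → Row
      hs = horRows hf
      vs = verRows vf

    isPerfectMatching-rows :
      isPerfectMatching M ≡ and (tabulate {n = suc r} λ y → admissible (hs (toℕ y)) (vs (toℕ y)) (below none vs (toℕ y)))
    isPerfectMatching-rows =
      ≡.trans (allB-∧ (λ y → degree M col₀ y ≡ᵇ 1) (λ y → degree M col₁ y ≡ᵇ 1) (allFin (suc r)))
      (≡.cong and (≡.trans (Listₚ.map-tabulate (λ y → y) _) (Listₚ.tabulate-cong row-degrees)))
      where
      row-degrees : ∀ y → ((degree M col₀ y ≡ᵇ 1) ∧ ((degree M col₁ y ≡ᵇ 1) ∧ true))
                          ≡ admissible (hs (toℕ y)) (vs (toℕ y)) (below none vs (toℕ y))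
      row-degrees Fin.zero    = ≡.refl
      row-degrees (Fin.suc y) = ≡.cong (λ h → admissible (rowOf h) (vs (suc (toℕ y))) (vs (toℕ y)))
                                       (≡.sym (atℕ-toℕ hf (λ _ → false) (Fin.suc y)))

    homology₁-rows : proj₁ (homologyClass M) ≡ sumℤ (tabulate {n = suc r} λ y → rowWinding (hs (toℕ y)) (toℕ y ℕ.+ 0))
    homology₁-rows = ≡.cong sumℤ (≡.trans (Listₚ.map-tabulate (λ y → y) (λ y → rowWinding (rowOf (hf y)) (toℕ y)))
      (Listₚ.tabulate-cong λ y →
        ≡.cong₂ rowWinding (≡.cong rowOf (≡.sym (atℕ-toℕ hf (λ _ → false) y))) (≡.sym (ℕₚ.+-identityʳ (toℕ y)))))

    homology₂-perfect : isPerfectMatching M ≡ true → proj₂ (homologyClass M) ≡ + 0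
    homology₂-perfect pm = ≡.trans (≡.cong₂ (winding₂ (vs 0)) (atℕ-const r false 0) (atℕ-const r false 0))
                                   (balanced⇒0 (vs 0) (admissible-none⇒balanced (hs 0) (vs 0) first-row))
      where
      winding₂ : Row → Bool → Bool → ℤ
      winding₂ v a b = sgn false ℤ.* (χℤ (proj₁ v) ℤ.- χℤ a) ℤ.+ (sgn true ℤ.* (χℤ (proj₂ v) ℤ.- χℤ b) ℤ.+ + 0)
      first-row : admissible (hs 0) (vs 0) none ≡ true
      first-row = Boolₚ.∧-conicalˡ _ _ (≡.trans (≡.sym isPerfectMatching-rows) pm)
      balanced⇒0 : ∀ v → proj₁ v ≡ proj₂ v → winding₂ v false false ≡ + 0
      balanced⇒0 (false , false) _ = ≡.refl
      balanced⇒0 (true  , true)  _ = ≡.refl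

    weight-rows : weight A M ≈ ∏ (tabulate {n = suc r} λ y → rowWeight (hs (toℕ y)) (vs (toℕ y)) (toℕ y ℕ.+ 0))
    weight-rows = begin
      weight A M
        ≈⟨ *-cong (∏-concatMap-tabulate (edgeFactors (horFaces r) hf) (λ y → y))
                  (∏-concatMap-tabulate (edgeFactors (verFaces r) vf) (λ y → y)) ⟩
      ∏ (tabulate λ y → pairWeight (horFaces r) (rowOf (hf y)) (toℕ y))
        * ∏ (tabulate λ y → pairWeight (verFaces r) (rowOf (vf y)) (toℕ y))
        ≡⟨ ≡.cong₂ (λ h v → ∏ h * ∏ v)
             (Listₚ.tabulate-cong λ y → ≡.cong₂ (pairWeight (horFaces r))
               (≡.cong rowOf (≡.sym (atℕ-toℕ hf (λ _ → false) y))) (≡.sym (ℕₚ.+-identityʳ (toℕ y))))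
             (Listₚ.tabulate-cong λ y → ≡.cong₂ (pairWeight (verFaces r))
               (≡.cong₂ _,_ (≡.sym (atℕ-toℕ (λ j → vf j col₀) false y)) (≡.sym (atℕ-toℕ (λ j → vf j col₁) false y)))
               (≡.sym (ℕₚ.+-identityʳ (toℕ y)))) ⟩
      ∏ (tabulate {n = suc r} λ y → horizontal (toℕ y)) * ∏ (tabulate {n = r} λ y → vertical (toℕ y))
        ≈⟨ *-congˡ (∏-tabulate-extend r vertical no-edges-above) ⟩
      ∏ (tabulate {n = suc r} λ y → horizontal (toℕ y)) * ∏ (tabulate {n = suc r} λ y → vertical (toℕ y))
        ≈⟨ ∏-tabulate-* {n = suc r} (horizontal ∘ toℕ) (vertical ∘ toℕ) ⟩
      ∏ (tabulate {n = suc r} λ y → rowWeight (hs (toℕ y)) (vs (toℕ y)) (toℕ y ℕ.+ 0)) ∎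
      where
      edgeFactors : ∀ {n} → (Fin 2 → ℕ → ℕ × ℕ) → (Fin n → Fin 2 → Bool) → Fin n → List Carrier
      edgeFactors faces ef y = map (λ c → if ef y c then edgeWeight A (faces c (toℕ y)) else 1#) (allFin 2)
      horizontal vertical : ℕ → Carrier
      horizontal i = pairWeight (horFaces r) (hs i) (i ℕ.+ 0)
      vertical   i = pairWeight (verFaces r) (vs i) (i ℕ.+ 0)
      no-edges-above : vertical r ≈ 1#
      no-edges-above = trans (reflexive (≡.cong₂ (λ a b → pairWeight (verFaces r) (a , b) (r ℕ.+ 0))
                                                  (atℕ-beyond r (λ j → vf j col₀) false) (atℕ-beyond r (λ j → vf j col₁) false)))
                             (trans (*-identityˡ _) (*-identityˡ _))

    term-rows : ∀ h₁ h₂ c →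
      when (isPerfectMatching M ∧ ⌊ proj₁ (homologyClass M) ℤ.≟ h₁ ⌋ ∧ ⌊ proj₂ (homologyClass M) ℤ.≟ h₂ ⌋)
           (weight A M * c)
      ≈ when ⌊ + 0 ℤ.≟ h₂ ⌋ (stripWeight (suc r) hs vs none 0 h₁) * c
    term-rows h₁ h₂ c = begin
      when (pm ∧ first ∧ ⌊ proj₂ (homologyClass M) ℤ.≟ h₂ ⌋) (weight A M * c)
        ≡⟨ ≡.cong (λ b → when b (weight A M * c))
                  (∧-guard-swap pm first λ pm≡true → ≡.cong (λ z → ⌊ z ℤ.≟ h₂ ⌋) (homology₂-perfect pm≡true)) ⟩
      when (second ∧ (pm ∧ first)) (weight A M * c)
        ≡⟨ when-∧ second (pm ∧ first) _ ⟩
      when second (when (pm ∧ first) (weight A M * c))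
        ≈⟨ when-cong second (sym (when-*ʳ (pm ∧ first) _ c)) ⟩
      when second (when (pm ∧ first) (weight A M) * c)
        ≈⟨ when-cong second (*-congʳ (when-cong (pm ∧ first) weight-rows)) ⟩
      when second (when (pm ∧ first) (∏ weights) * c)
        ≡⟨ ≡.cong₂ (λ a b → when second (when (a ∧ ⌊ b ℤ.≟ h₁ ⌋) (∏ weights) * c))
                   isPerfectMatching-rows homology₁-rows ⟩
      when second (when (and oks ∧ ⌊ sumℤ winds ℤ.≟ h₁ ⌋) (∏ weights) * c)
        ≈⟨ when-cong second (*-congʳ (stripWeight-closedForm (suc r) hs vs none 0 h₁)) ⟩
      when second (stripWeight (suc r) hs vs none 0 h₁ * c)
        ≈⟨ sym (when-*ʳ second _ c) ⟩
      when second (stripWeight (suc r) hs vs none 0 h₁) * c ∎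
      where
      pm = isPerfectMatching M
      first = ⌊ proj₁ (homologyClass M) ℤ.≟ h₁ ⌋
      second = ⌊ + 0 ℤ.≟ h₂ ⌋
      oks = tabulate {n = suc r} λ y → admissible (hs (toℕ y)) (vs (toℕ y)) (below none vs (toℕ y))
      winds = tabulate {n = suc r} λ y → rowWinding (hs (toℕ y)) (toℕ y ℕ.+ 0)
      weights = tabulate {n = suc r} λ y → rowWeight (hs (toℕ y)) (vs (toℕ y)) (toℕ y ℕ.+ 0)

  H-transfer : ∀ h₁ h₂ → H r (h₁ , h₂) A ≈ when ⌊ + 0 ℤ.≟ h₂ ⌋ (transfer r none 0 h₁) * weight A (M₀ r) ⁻¹
  H-transfer h₁ h₂ = begin
    ∑ (allEdgeSets r) term
      ≈⟨ ∑-concatMap (λ hf → map (edgeSet hf) vfs) term hfs ⟩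
    ∑ hfs (λ hf → ∑ (map (edgeSet hf) vfs) term)
      ≈⟨ ∑-cong hfs (λ hf → reflexive (∑-map (edgeSet hf) term vfs)) ⟩
    ∑ hfs (λ hf → ∑ vfs λ vf → term (edgeSet hf vf))
      ≈⟨ ∑-cong hfs (λ hf → ∑-cong vfs λ vf → term-rows hf vf h₁ h₂ c) ⟩
    ∑ hfs (λ hf → ∑ vfs λ vf → when second (strip hf vf) * c)
      ≈⟨ trans (∑-cong hfs (λ hf → ∑-*ʳ c _ vfs)) (∑-*ʳ c _ hfs) ⟩
    (∑ hfs λ hf → ∑ vfs λ vf → when second (strip hf vf)) * c
      ≈⟨ *-congʳ (trans (∑-cong hfs (λ hf → ∑-when second _ vfs)) (∑-when second _ hfs)) ⟩
    when second (∑ hfs λ hf → ∑ vfs λ vf → strip hf vf) * c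
      ≈⟨ *-congʳ (when-cong second (∑-stripWeight r none 0 h₁)) ⟩
    when second (transfer r none 0 h₁) * c ∎
    where
    hfs = allFuns (suc r) rowPatterns
    vfs = allFuns r rowPatterns
    c = weight A (M₀ r) ⁻¹
    second = ⌊ + 0 ℤ.≟ h₂ ⌋
    term : EdgeSet r → Carrier
    term M = when (isPerfectMatching M ∧ ⌊ proj₁ (homologyClass M) ℤ.≟ h₁ ⌋ ∧ ⌊ proj₂ (homologyClass M) ℤ.≟ h₂ ⌋)
                  (weight A M * c)
    strip : (Fin (suc r) → Fin 2 → Bool) → (Fin r → Fin 2 → Bool) → Carrier
    strip hf vf = stripWeight (suc r) (horRows hf) (verRows vf) none 0 h₁

  weight-reference : weight A (M₀ r) ≈ prodFrom α (suc r) 0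
  weight-reference = begin
    weight A (M₀ r)
      ≈⟨ weight-rows hf₀ vf₀ ⟩
    ∏ (tabulate {n = suc r} λ y → rowWeight (horRows hf₀ (toℕ y)) (verRows vf₀ (toℕ y)) (toℕ y ℕ.+ 0))
      ≡⟨ ≡.cong ∏ (Listₚ.tabulate-cong λ y → ≡.cong₂ (λ h v → rowWeight h v (toℕ y ℕ.+ 0))
           (≡.trans (≡.cong rowOf (atℕ-toℕ hf₀ (λ _ → false) y)) (≡.cong referenceRow (≡.sym (ℕₚ.+-identityʳ (toℕ y)))))
           (≡.cong₂ _,_ (atℕ-const r false (toℕ y)) (atℕ-const r false (toℕ y)))) ⟩
    ∏ (tabulate {n = suc r} λ y → α (toℕ y ℕ.+ 0))
      ≈⟨ ∏-tabulate≈prodFrom α (suc r) 0 ⟩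
    prodFrom α (suc r) 0 ∎
    where
    hf₀ : Fin (suc r) → Fin 2 → Bool
    hf₀ y c = black c (toℕ y)
    vf₀ : Fin r → Fin 2 → Bool
    vf₀ _ _ = false

module FaceLabels (r : ℕ) where
  open Rows using (col₀; col₁)

  -- Row a ∈ [1, r] consists of the squares labelled a and r + a; beyond the rows lies the annulus 0.
  firstLabel secondLabel : ℕ → ℕ
  firstLabel a = if a ≤ᵇ r then a else 0
  secondLabel zero    = 0
  secondLabel (suc a) = if suc a ≤ᵇ r then r ℕ.+ suc a else 0

  firstLabel-row : ∀ a → a ≤ r → firstLabel a ≡ a
  firstLabel-row a a≤r rewrite T⇒≡true (ℕₚ.≤⇒≤ᵇ a≤r) = ≡.refl

  secondLabel-row : ∀ a → suc a ≤ r → secondLabel (suc a) ≡ r ℕ.+ suc a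
  secondLabel-row a a<r rewrite T⇒≡true (ℕₚ.≤⇒≤ᵇ a<r) = ≡.refl

  firstLabel-beyond : ∀ a → r < a → firstLabel a ≡ 0
  firstLabel-beyond a r<a rewrite ¬T⇒≡false (λ t → ℕₚ.<⇒≱ r<a (ℕₚ.≤ᵇ⇒≤ a r t)) = ≡.refl

  secondLabel-beyond : ∀ a → r < suc a → secondLabel (suc a) ≡ 0
  secondLabel-beyond a r<a rewrite ¬T⇒≡false (λ t → ℕₚ.<⇒≱ r<a (ℕₚ.≤ᵇ⇒≤ (suc a) r t)) = ≡.refl

  squareLabel-first : ∀ c a → odd (toℕ c) ≡ not (odd a) → squareLabel r c a ≡ a
  squareLabel-first c a e = ≡.trans (≡.cong (λ b → if odd a xor b then a else r ℕ.+ a) e) (differ (odd a))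
    where
    differ : ∀ p → (if p xor not p then a else r ℕ.+ a) ≡ a
    differ true  = ≡.refl
    differ false = ≡.refl

  squareLabel-second : ∀ c a → odd (toℕ c) ≡ odd a → squareLabel r c a ≡ r ℕ.+ a
  squareLabel-second c a e = ≡.trans (≡.cong (λ b → if odd a xor b then a else r ℕ.+ a) e) (agree (odd a))
    where
    agree : ∀ p → (if p xor p then a else r ℕ.+ a) ≡ r ℕ.+ a
    agree true  = ≡.refl
    agree false = ≡.refl

  above-row : ∀ m L → m ≤ r → (if m ≡ᵇ r then 0 else L) ≡ (if suc m ≤ᵇ r then L else 0)
  above-row m L m≤r with ℕₚ.m≤n⇒m<n∨m≡n m≤r
  ... | inj₁ m<r
    rewrite T⇒≡true (ℕₚ.≤⇒≤ᵇ m<r) | ¬T⇒≡false (λ t → ℕₚ.<⇒≢ m<r (ℕₚ.≡ᵇ⇒≡ m r t)) = ≡.refl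
  ... | inj₂ ≡.refl
    rewrite T⇒≡true (ℕₚ.≡⇒≡ᵇ m m ≡.refl) | ¬T⇒≡false (λ t → ℕₚ.<-irrefl ≡.refl (ℕₚ.≤ᵇ⇒≤ (suc m) m t)) = ≡.refl

  horFaces-reference : ∀ c m → m ≤ r → odd (toℕ c) ≡ not (odd m) → horFaces r c m ≡ (firstLabel m , secondLabel (suc m))
  horFaces-reference c zero    m≤r e =
    ≡.cong (0 ,_) (≡.trans (≡.cong (λ L → if 0 ≡ᵇ r then 0 else L) (squareLabel-second c 1 e)) (above-row 0 _ m≤r))
  horFaces-reference c (suc m) m≤r e = ≡.cong₂ _,_
    (≡.trans (squareLabel-first c (suc m) e) (≡.sym (firstLabel-row (suc m) m≤r)))
    (≡.trans (≡.cong (λ L → if suc m ≡ᵇ r then 0 else L) (squareLabel-second c (suc (suc m)) e)) (above-row (suc m) _ m≤r))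

  horFaces-other : ∀ c m → m ≤ r → odd (toℕ c) ≡ odd m → horFaces r c m ≡ (secondLabel m , firstLabel (suc m))
  horFaces-other c zero    m≤r e =
    ≡.cong (0 ,_) (≡.trans (≡.cong (λ L → if 0 ≡ᵇ r then 0 else L) (squareLabel-first c 1 e)) (above-row 0 _ m≤r))
  horFaces-other c (suc m) m≤r e = ≡.cong₂ _,_
    (≡.trans (squareLabel-second c (suc m) e) (≡.sym (secondLabel-row m m≤r)))
    (≡.trans (≡.cong (λ L → if suc m ≡ᵇ r then 0 else L)
                     (squareLabel-first c (suc (suc m)) (≡.trans e (≡.sym (Boolₚ.not-involutive _)))))
             (above-row (suc m) _ m≤r))

  verFaces-labels : ∀ x m → suc m ≤ r →
    verFaces r x m ≡ (firstLabel (suc m) , secondLabel (suc m)) ⊎ verFaces r x m ≡ (secondLabel (suc m) , firstLabel (suc m))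
  verFaces-labels x m m<r with odd (suc m)
  ... | true  = inj₁ (≡.cong₂ _,_ (≡.sym (firstLabel-row (suc m) m<r)) (≡.sym (secondLabel-row m m<r)))
  ... | false = inj₂ (≡.cong₂ _,_ (≡.sym (secondLabel-row m m<r)) (≡.sym (firstLabel-row (suc m) m<r)))

module Normalisation (F : Field 0ℓ 0ℓ) (r : ℕ) (A : ℕ → Field.Carrier F) where
  open Field F hiding (zero)
  open Hamiltonian F using (faceWeight; edgeWeight; weight; H)
  open Sums commutativeRing
  open Continuants commutativeRing
  open Fractions F
  open Rows
  open Dimers F r A
  open FaceLabels r
  open SetoidReasoning setoid
  open NatSolver commutativeSemiring

  X Y : ℕ → Carrier
  X a = faceWeight A (firstLabel a)
  Y a = faceWeight A (secondLabel a)

  private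
    singleEdge₀ : ∀ e → (e * (1# * 1#)) * (1# * (1# * 1#)) ≈ e
    singleEdge₀ = solve 1 (λ e → (e :* (con 1 :* con 1)) :* (con 1 :* (con 1 :* con 1)) := e) refl

    singleEdge₁ : ∀ e → (1# * (e * 1#)) * (1# * (1# * 1#)) ≈ e
    singleEdge₁ = solve 1 (λ e → (con 1 :* (e :* con 1)) :* (con 1 :* (con 1 :* con 1)) := e) refl

  α≈ : ∀ m → m ≤ r → α m ≈ (X m * Y (suc m)) ⁻¹
  α≈ m m≤r = reference (odd m) ≡.refl
    where
    reference : ∀ p → odd m ≡ p → rowWeight (p , not p) none m ≈ (X m * Y (suc m)) ⁻¹
    reference true  e =
      trans (singleEdge₀ _) (reflexive (≡.cong (edgeWeight A) (horFaces-reference col₀ m m≤r (≡.sym (≡.cong not e)))))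
    reference false e =
      trans (singleEdge₁ _) (reflexive (≡.cong (edgeWeight A) (horFaces-reference col₁ m m≤r (≡.sym (≡.cong not e)))))

  β≈ : ∀ m → m ≤ r → β m ≈ (Y m * X (suc m)) ⁻¹
  β≈ m m≤r = other (odd m) ≡.refl
    where
    other : ∀ p → odd m ≡ p → rowWeight (not p , p) none m ≈ (Y m * X (suc m)) ⁻¹
    other true  e = trans (singleEdge₁ _) (reflexive (≡.cong (edgeWeight A) (horFaces-other col₁ m m≤r (≡.sym e))))
    other false e = trans (singleEdge₀ _) (reflexive (≡.cong (edgeWeight A) (horFaces-other col₀ m m≤r (≡.sym e))))

  module _ (X≉0 : ∀ a → NonZero (X a)) (Y≉0 : ∀ a → NonZero (Y a)) where

    verticalEdge≈ : ∀ x m → suc m ≤ r → edgeWeight A (verFaces r x m) ≈ (X (suc m) * Y (suc m)) ⁻¹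
    verticalEdge≈ x m m<r with verFaces-labels x m m<r
    ... | inj₁ faces≡ = reflexive (≡.cong (edgeWeight A) faces≡)
    ... | inj₂ faces≡ =
      trans (reflexive (≡.cong (edgeWeight A) faces≡)) (⁻¹-cong (*-nonZero (Y≉0 (suc m)) (X≉0 (suc m))) (*-comm _ _))

    ε≈ : ∀ m → m < r → ε m ≈ (X (suc m) * Y (suc m)) ⁻¹ * (X (suc m) * Y (suc m)) ⁻¹
    ε≈ m m<r = trans (solve 2 (λ a b → (con 1 :* (con 1 :* con 1)) :* (a :* (b :* con 1)) := a :* b) refl _ _)
                     (*-cong (verticalEdge≈ col₀ m m<r) (verticalEdge≈ col₁ m m<r))

    α-horizontalRatio : ∀ m → m ≤ r → α m * horizontalRatio X Y m ≈ β m
    α-horizontalRatio m m≤r = begin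
      α m * horizontalRatio X Y m                                  ≈⟨ *-congʳ (α≈ m m≤r) ⟩
      (X m * Y (suc m)) ⁻¹ * ((X m * Y (suc m)) * (Y m * X (suc m)) ⁻¹)
        ≈⟨ sym (*-assoc _ _ _) ⟩
      ((X m * Y (suc m)) ⁻¹ * (X m * Y (suc m))) * (Y m * X (suc m)) ⁻¹
        ≈⟨ *-congʳ (*-inverseˡ (*-nonZero (X≉0 m) (Y≉0 (suc m)))) ⟩
      1# * (Y m * X (suc m)) ⁻¹                                    ≈⟨ *-identityˡ _ ⟩
      (Y m * X (suc m)) ⁻¹                                         ≈⟨ sym (β≈ m m≤r) ⟩
      β m                                                          ∎

    α-verticalRatio : ∀ m → m < r → (α m * α (suc m)) * verticalRatio X Y m ≈ ε m
    α-verticalRatio m m<r = begin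
      (α m * α (suc m)) * verticalRatio X Y m
        ≈⟨ *-congʳ (*-cong (trans (α≈ m (ℕₚ.<⇒≤ m<r)) (⁻¹-distrib-* (X≉0 m) (Y≉0 (suc m))))
                           (trans (α≈ (suc m) m<r) (⁻¹-distrib-* (X≉0 (suc m)) (Y≉0 (suc (suc m)))))) ⟩
      ((x₀ ⁻¹ * y₁ ⁻¹) * (x₁ ⁻¹ * y₂ ⁻¹)) * (x₀ * y₂ * v)
        ≈⟨ solve 7 (λ a a′ b b′ c d w → ((a′ :* c) :* (d :* b′)) :* (a :* b :* w) := (a :* a′) :* (b :* b′) :* (c :* d :* w))
                   refl x₀ (x₀ ⁻¹) y₂ (y₂ ⁻¹) (y₁ ⁻¹) (x₁ ⁻¹) v ⟩
      (x₀ * x₀ ⁻¹) * (y₂ * y₂ ⁻¹) * (y₁ ⁻¹ * x₁ ⁻¹ * v)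
        ≈⟨ *-congʳ (*-cong (*-inverseʳ (X≉0 m)) (*-inverseʳ (Y≉0 (suc (suc m))))) ⟩
      1# * 1# * (y₁ ⁻¹ * x₁ ⁻¹ * v)
        ≈⟨ trans (*-congʳ (*-identityˡ 1#)) (*-identityˡ _) ⟩
      y₁ ⁻¹ * x₁ ⁻¹ * v
        ≈⟨ *-congʳ (trans (*-comm _ _) (sym (⁻¹-distrib-* (X≉0 (suc m)) (Y≉0 (suc m))))) ⟩
      v * v
        ≈⟨ sym (ε≈ m m<r) ⟩
      ε m ∎
      where
      x₀ = X m
      x₁ = X (suc m)
      y₁ = Y (suc m)
      y₂ = Y (suc (suc m))
      v = (x₁ * y₁) ⁻¹

    H-continuant : ∀ h₁ h₂ →
      H r (h₁ , h₂) A ≈ when ⌊ + 0 ℤ.≟ h₂ ⌋ (continuant 1s (horizontalRatio X Y) (verticalRatio X Y) (suc r) 0 h₁)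
    H-continuant h₁ h₂ = begin
      H r (h₁ , h₂) A
        ≈⟨ H-transfer h₁ h₂ ⟩
      when second (transfer r none 0 h₁) * weight A (M₀ r) ⁻¹
        ≈⟨ *-congʳ (when-cong second (trans (transfer-none r 0 h₁)
             (continuant-rescale α β ε _ _ r α-horizontalRatio α-verticalRatio (suc r) 0 h₁
                                 (ℕₚ.≤-reflexive (ℕₚ.+-identityʳ (suc r)))))) ⟩
      when second (P * K) * weight A (M₀ r) ⁻¹
        ≈⟨ when-*ʳ second (P * K) _ ⟩
      when second ((P * K) * weight A (M₀ r) ⁻¹)
        ≈⟨ when-cong second (*-congˡ (⁻¹-cong (nonZero-cong (sym weight-reference) P≉0) weight-reference)) ⟩
      when second ((P * K) * P ⁻¹)
        ≈⟨ when-cong second (trans (*-congʳ (*-comm P K))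
                           (trans (*-assoc K P (P ⁻¹)) (trans (*-congˡ (*-inverseʳ P≉0)) (*-identityʳ K)))) ⟩
      when second K ∎
      where
      second = ⌊ + 0 ℤ.≟ h₂ ⌋
      P = prodFrom α (suc r) 0
      K = continuant 1s (horizontalRatio X Y) (verticalRatio X Y) (suc r) 0 h₁
      P≉0 : NonZero P
      P≉0 = prodFrom-nonZero α (suc r) 0 λ i i<r+1 →
        nonZero-cong (sym (α≈ i (ℕₚ.≤-pred (≡.subst (i <_) (ℕₚ.+-identityʳ (suc r)) i<r+1))))
                     (⁻¹-nonZero (*-nonZero (X≉0 i) (Y≉0 (suc i))))

module QSystem (F : Field 0ℓ 0ℓ) where
  open Field F hiding (zero)
  open Fractions F
  open Continuants commutativeRing
  open SetoidReasoning setoid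
  open NatSolver commutativeSemiring

  previous : (ℕ → Carrier) → ℕ → Carrier
  previous y zero    = 0#
  previous y (suc i) = y i

  continuant-conserved : ∀ (x y z : ℕ → Carrier) r →
    (∀ i → NonZero (x i)) → (∀ i → NonZero (y i)) → (∀ i → NonZero (z i)) →
    (∀ i → i ≤ r → x i * z i ≈ y i * y i + y (suc i) * previous y i) →
    x (suc r) ≈ 1# → y (suc r) ≈ 1# → z (suc r) ≈ 1# →
    ∀ τ → continuant 1s (horizontalRatio x y) (verticalRatio x y) (suc r) 0 τ
        ≈ continuant 1s (horizontalRatio y z) (verticalRatio y z) (suc r) 0 τ
  continuant-conserved x y z r x≉0 y≉0 z≉0 qsystem x-top y-top z-top =
    continuant-refactor t d t′ D r sum-rel sum-rel-top product-rel D₀≈0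
    where
    t d t′ D : ℕ → Carrier
    t  = horizontalRatio x y
    d  = verticalRatio x y
    t′ = horizontalRatio y z
    -- D ∘ suc is definitionally verticalRatio y z.
    D m = (previous y m * z (suc m)) / (y m * z m)

    N Den : ℕ → Carrier
    N m = y m * z (suc m) * (y m * z m) + previous y m * z (suc m) * (z m * y (suc m))
    Den m = (z m * y (suc m)) * (y m * z m)

    Den≉0 : ∀ m → NonZero (Den m)
    Den≉0 m = *-nonZero (*-nonZero (z≉0 m) (y≉0 (suc m))) (*-nonZero (y≉0 m) (z≉0 m))

    t′+D : ∀ m → t′ m + D m ≈ N m / Den m
    t′+D m = /-+-/ (*-nonZero (z≉0 m) (y≉0 (suc m))) (*-nonZero (y≉0 m) (z≉0 m))

    N≈ : ∀ m → m ≤ r → N m ≈ z (suc m) * z m * (x m * z m)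
    N≈ m m≤r = begin
      N m
        ≈⟨ solve 5 (λ a b c p e → a :* b :* (a :* c) :+ p :* b :* (c :* e) := b :* c :* (a :* a :+ e :* p))
                   refl (y m) (z (suc m)) (z m) (previous y m) (y (suc m)) ⟩
      z (suc m) * z m * (y m * y m + y (suc m) * previous y m)   ≈⟨ *-congˡ (sym (qsystem m m≤r)) ⟩
      z (suc m) * z m * (x m * z m)                               ∎

    sum-rel : ∀ m → m < r → t′ m + D m ≈ t m + d m
    sum-rel m m<r = begin
      t′ m + D m        ≈⟨ t′+D m ⟩
      N m / Den m       ≈⟨ /-cross (Den≉0 m) Den′≉0 cross ⟩
      N′ / Den′         ≈⟨ sym (/-+-/ (*-nonZero (y≉0 m) (x≉0 (suc m))) (*-nonZero (x≉0 (suc m)) (y≉0 (suc m)))) ⟩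
      t m + d m         ∎
      where
      N′ = x m * y (suc m) * (x (suc m) * y (suc m)) + x m * y (suc (suc m)) * (y m * x (suc m))
      Den′ = (y m * x (suc m)) * (x (suc m) * y (suc m))
      Den′≉0 : NonZero Den′
      Den′≉0 = *-nonZero (*-nonZero (y≉0 m) (x≉0 (suc m))) (*-nonZero (x≉0 (suc m)) (y≉0 (suc m)))
      N′≈ : N′ ≈ x m * x (suc m) * (x (suc m) * z (suc m))
      N′≈ = begin
        N′  ≈⟨ solve 5 (λ a b c e f → a :* b :* (c :* b) :+ a :* e :* (f :* c) := a :* c :* (b :* b :+ e :* f))
                       refl (x m) (y (suc m)) (x (suc m)) (y (suc (suc m))) (y m) ⟩
        x m * x (suc m) * (y (suc m) * y (suc m) + y (suc (suc m)) * y m)  ≈⟨ *-congˡ (sym (qsystem (suc m) m<r)) ⟩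
        x m * x (suc m) * (x (suc m) * z (suc m))                           ∎
      cross : N m * Den′ ≈ N′ * Den m
      cross = begin
        N m * Den′                                          ≈⟨ *-congʳ (N≈ m (ℕₚ.<⇒≤ m<r)) ⟩
        z (suc m) * z m * (x m * z m) * Den′
          ≈⟨ solve 6 (λ z₁ z₀ x₀ y₀ x₁ y₁ → z₁ :* z₀ :* (x₀ :* z₀) :* ((y₀ :* x₁) :* (x₁ :* y₁))
                                        := x₀ :* x₁ :* (x₁ :* z₁) :* ((z₀ :* y₁) :* (y₀ :* z₀)))
                     refl (z (suc m)) (z m) (x m) (y m) (x (suc m)) (y (suc m)) ⟩
        x m * x (suc m) * (x (suc m) * z (suc m)) * Den m   ≈⟨ *-congʳ (sym N′≈) ⟩
        N′ * Den m                                          ∎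

    sum-rel-top : t′ r + D r ≈ t r
    sum-rel-top = begin
      t′ r + D r     ≈⟨ t′+D r ⟩
      N r / Den r    ≈⟨ /-cross (Den≉0 r) (*-nonZero (y≉0 r) (x≉0 (suc r))) cross ⟩
      t r            ∎
      where
      cross : N r * (y r * x (suc r)) ≈ (x r * y (suc r)) * Den r
      cross = begin
        N r * (y r * x (suc r))                           ≈⟨ *-congʳ (N≈ r ℕₚ.≤-refl) ⟩
        z (suc r) * z r * (x r * z r) * (y r * x (suc r)) ≈⟨ *-cong (*-congʳ (*-congʳ z-top)) (*-congˡ x-top) ⟩
        1# * z r * (x r * z r) * (y r * 1#)
          ≈⟨ solve 3 (λ z₀ x₀ y₀ → con 1 :* z₀ :* (x₀ :* z₀) :* (y₀ :* con 1) := (x₀ :* con 1) :* ((z₀ :* con 1) :* (y₀ :* z₀)))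
                     refl (z r) (x r) (y r) ⟩
        (x r * 1#) * ((z r * 1#) * (y r * z r))           ≈⟨ sym (*-cong (*-congˡ y-top) (*-congʳ (*-congˡ y-top))) ⟩
        (x r * y (suc r)) * Den r                         ∎

    product-rel : ∀ m → m < r → D (suc m) * t m ≈ d m * t′ (suc m)
    product-rel m m<r = begin
      D (suc m) * t m
        ≈⟨ /-*-/ (*-nonZero (y≉0 (suc m)) (z≉0 (suc m))) (*-nonZero (y≉0 m) (x≉0 (suc m))) ⟩
      (y m * z (suc (suc m)) * (x m * y (suc m))) / ((y (suc m) * z (suc m)) * (y m * x (suc m)))
        ≈⟨ /-cross (*-nonZero (*-nonZero (y≉0 (suc m)) (z≉0 (suc m))) (*-nonZero (y≉0 m) (x≉0 (suc m))))
                   (*-nonZero (*-nonZero (x≉0 (suc m)) (y≉0 (suc m))) (*-nonZero (z≉0 (suc m)) (y≉0 (suc (suc m)))))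
                   (solve 7 (λ y₀ z₂ x₀ y₁ x₁ z₁ y₂ → (y₀ :* z₂ :* (x₀ :* y₁)) :* ((x₁ :* y₁) :* (z₁ :* y₂))
                                                     := (x₀ :* y₂ :* (y₁ :* z₂)) :* ((y₁ :* z₁) :* (y₀ :* x₁)))
                          refl (y m) (z (suc (suc m))) (x m) (y (suc m)) (x (suc m)) (z (suc m)) (y (suc (suc m)))) ⟩
      (x m * y (suc (suc m)) * (y (suc m) * z (suc (suc m)))) / ((x (suc m) * y (suc m)) * (z (suc m) * y (suc (suc m))))
        ≈⟨ sym (/-*-/ (*-nonZero (x≉0 (suc m)) (y≉0 (suc m))) (*-nonZero (z≉0 (suc m)) (y≉0 (suc (suc m))))) ⟩
      d m * t′ (suc m) ∎

    D₀≈0 : D 0 ≈ 0#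
    D₀≈0 = trans (*-congʳ (zeroˡ _)) (zeroˡ _)

module QSystemFaceWeights (F : Field 0ℓ 0ℓ) (r : ℕ) (Q : ℕ → ℤ → Field.Carrier F) (κ : ℤ) where
  open Field F hiding (zero)
  open Hamiltonian F using (faceWeight; qArgs)
  open FaceLabels r
  open Normalisation F r (qArgs r Q κ) public using (X; Y)

  X-row : ∀ a → suc a ≤ r → X (suc a) ≡ Q (suc a) κ
  X-row a a<r rewrite firstLabel-row (suc a) a<r | T⇒≡true (ℕₚ.≤⇒≤ᵇ a<r) = ≡.refl

  Y-row : ∀ a → suc a ≤ r → Y (suc a) ≡ Q (suc a) (κ ℤ.+ + 1)
  Y-row a a<r rewrite secondLabel-row a a<r | ℕₚ.+-suc r a
                    | ¬T⇒≡false (λ t → ℕₚ.<⇒≱ (s≤s (ℕₚ.m≤m+n r a)) (ℕₚ.≤ᵇ⇒≤ (suc (r ℕ.+ a)) r t))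
                    | ≡.sym (ℕₚ.+-suc r a) | ℕₚ.m+n∸m≡n r (suc a) = ≡.refl

  X-beyond : ∀ a → r < a → X a ≡ 1#
  X-beyond a r<a rewrite firstLabel-beyond a r<a = ≡.refl

  Y-beyond : ∀ a → r < suc a → Y (suc a) ≡ 1#
  Y-beyond a r<a rewrite secondLabel-beyond a r<a = ≡.refl

module Conservation (F : Field 0ℓ 0ℓ) where
  open Field F hiding (zero)
  open Hamiltonian F using (H; qArgs)
  open Sums commutativeRing using (when; when-cong)
  open Continuants commutativeRing using (continuant; continuant-cong; 1s)
  open Fractions F
  open QSystem F
  open SetoidReasoning setoid

  module _ (r : ℕ) (Q : ℕ → ℤ → Carrier)
           (Q≉0 : ∀ a k → 1 ≤ a → a ≤ r → ¬ (Q a k ≈ 0#))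
           (Q₀≈1 : ∀ k → Q 0 k ≈ 1#) (Q-top≈1 : ∀ k → Q (suc r) k ≈ 1#)
           (qsystem : ∀ a k → 1 ≤ a → a ≤ r →
                      (Q a (k ℤ.+ + 1) * Q a (k ℤ.- + 1)) ≈ ((Q a k * Q a k) + (Q (suc a) k * Q (a ∸ 1) k)))
           where

    private
      X Y : ℤ → ℕ → Carrier
      X = QSystemFaceWeights.X F r Q
      Y = QSystemFaceWeights.Y F r Q
      module Faces κ = QSystemFaceWeights F r Q κ

    X≈Q : ∀ κ a → a ≤ suc r → X κ a ≈ Q a κ
    X≈Q κ zero    _       = sym (Q₀≈1 κ)
    X≈Q κ (suc a) a≤r+1 with ℕₚ.m≤n⇒m<n∨m≡n a≤r+1
    ... | inj₁ a<r+1 = reflexive (Faces.X-row κ a (ℕₚ.≤-pred a<r+1))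
    ... | inj₂ ≡.refl = trans (reflexive (Faces.X-beyond κ (suc r) ℕₚ.≤-refl)) (sym (Q-top≈1 κ))

    Y≈Q : ∀ κ a → a ≤ suc r → Y κ a ≈ Q a (κ ℤ.+ + 1)
    Y≈Q κ zero    _       = sym (Q₀≈1 _)
    Y≈Q κ (suc a) a≤r+1 with ℕₚ.m≤n⇒m<n∨m≡n a≤r+1
    ... | inj₁ a<r+1 = reflexive (Faces.Y-row κ a (ℕₚ.≤-pred a<r+1))
    ... | inj₂ ≡.refl = trans (reflexive (Faces.Y-beyond κ r ℕₚ.≤-refl)) (sym (Q-top≈1 _))

    X≉0 : ∀ κ a → NonZero (X κ a)
    X≉0 κ zero    = 1≉0
    X≉0 κ (suc a) with suc a ℕ.≤? r
    ... | yes a<r = nonZero-cong (reflexive (≡.sym (Faces.X-row κ a a<r))) (Q≉0 (suc a) κ (s≤s z≤n) a<r)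
    ... | no  a≮r = nonZero-cong (reflexive (≡.sym (Faces.X-beyond κ (suc a) (ℕₚ.≰⇒> a≮r)))) 1≉0

    Y≉0 : ∀ κ a → NonZero (Y κ a)
    Y≉0 κ zero    = 1≉0
    Y≉0 κ (suc a) with suc a ℕ.≤? r
    ... | yes a<r = nonZero-cong (reflexive (≡.sym (Faces.Y-row κ a a<r))) (Q≉0 (suc a) _ (s≤s z≤n) a<r)
    ... | no  a≮r = nonZero-cong (reflexive (≡.sym (Faces.Y-beyond κ a (ℕₚ.≰⇒> a≮r)))) 1≉0

    Y≈X-next : ∀ κ a → Y κ a ≈ X (κ ℤ.+ + 1) a
    Y≈X-next κ a with a ℕ.≤? suc r
    ... | yes a≤r+1 = trans (Y≈Q κ a a≤r+1) (sym (X≈Q _ a a≤r+1))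
    Y≈X-next κ zero    | no a≰r+1 = refl
    Y≈X-next κ (suc a) | no a≰r+1 = reflexive (≡.trans (Faces.Y-beyond κ a r<a+1) (≡.sym (Faces.X-beyond _ (suc a) r<a+1)))
      where r<a+1 = ℕₚ.<-trans (ℕₚ.n<1+n r) (ℕₚ.≰⇒> a≰r+1)

    qsystem-faces : ∀ κ i → i ≤ r → X κ i * Y (κ ℤ.+ + 1) i ≈ Y κ i * Y κ i + Y κ (suc i) * previous (Y κ) i
    qsystem-faces κ zero    _   = sym (trans (+-congˡ (zeroʳ _)) (+-identityʳ _))
    qsystem-faces κ (suc a) a<r = begin
      X κ i * Y κ₁ i                     ≈⟨ *-cong (X≈Q κ i i≤r+1) (Y≈Q κ₁ i i≤r+1) ⟩
      Q i κ * Q i (κ₁ ℤ.+ + 1)           ≈⟨ *-comm _ _ ⟩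
      Q i (κ₁ ℤ.+ + 1) * Q i κ           ≡⟨ ≡.cong (λ k → Q i (κ₁ ℤ.+ + 1) * Q i k) (≡.sym (κ+1-1≡κ κ)) ⟩
      Q i (κ₁ ℤ.+ + 1) * Q i (κ₁ ℤ.- + 1) ≈⟨ qsystem i κ₁ (s≤s z≤n) a<r ⟩
      Q i κ₁ * Q i κ₁ + Q (suc i) κ₁ * Q a κ₁
        ≈⟨ sym (+-cong (*-cong (Y≈Q κ i i≤r+1) (Y≈Q κ i i≤r+1))
                       (*-cong (Y≈Q κ (suc i) (s≤s a<r)) (Y≈Q κ a (ℕₚ.m≤n⇒m≤1+n (ℕₚ.<⇒≤ a<r))))) ⟩
      Y κ i * Y κ i + Y κ (suc i) * Y κ a ∎
      where
      i = suc a
      κ₁ = κ ℤ.+ + 1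
      i≤r+1 = ℕₚ.m≤n⇒m≤1+n a<r
      κ+1-1≡κ : ∀ κ → κ ℤ.+ + 1 ℤ.- + 1 ≡ κ
      κ+1-1≡κ = ℤ-Solver.solve-∀

    H-conserved : ∀ h k → H r h (qArgs r Q k) ≈ H r h (qArgs r Q (k ℤ.+ + 1))
    H-conserved (h₁ , h₂) k = begin
      H r (h₁ , h₂) (qArgs r Q k)
        ≈⟨ Normalisation.H-continuant F r (qArgs r Q k) (X≉0 k) (Y≉0 k) h₁ h₂ ⟩
      when second (continuant 1s (horizontalRatio (X k) (Y k)) (verticalRatio (X k) (Y k)) (suc r) 0 h₁)
        ≈⟨ when-cong second (continuant-conserved (X k) (Y k) (Y k₁) r (X≉0 k) (Y≉0 k) (Y≉0 k₁) (qsystem-faces k)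
                               (reflexive (Faces.X-beyond k (suc r) ℕₚ.≤-refl)) (reflexive (Faces.Y-beyond k r ℕₚ.≤-refl))
                               (reflexive (Faces.Y-beyond k₁ r ℕₚ.≤-refl)) h₁) ⟩
      when second (continuant 1s (horizontalRatio (Y k) (Y k₁)) (verticalRatio (Y k) (Y k₁)) (suc r) 0 h₁)
        ≈⟨ when-cong second (continuant-cong (λ _ → refl)
                               (horizontalRatio-congˡ (Y k₁) (Y≈X-next k) (Y≉0 k) (Y≉0 k₁))
                               (verticalRatio-congˡ (Y k₁) (Y≈X-next k) (Y≉0 k) (Y≉0 k₁)) (suc r) 0 h₁) ⟩
      when second (continuant 1s (horizontalRatio (X k₁) (Y k₁)) (verticalRatio (X k₁) (Y k₁)) (suc r) 0 h₁)
        ≈⟨ sym (Normalisation.H-continuant F r (qArgs r Q k₁) (X≉0 k₁) (Y≉0 k₁) h₁ h₂) ⟩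
      H r (h₁ , h₂) (qArgs r Q k₁) ∎
      where
      k₁ = k ℤ.+ + 1
      second = ⌊ + 0 ℤ.≟ h₂ ⌋

theorem5p1 : (F : Field 0ℓ 0ℓ) → let open Field F in
  (r : ℕ) → 1 ≤ r →
  (Q : ℕ → ℤ → Carrier) →
  (∀ a k → 1 ≤ a → a ≤ r → ¬ (Q a k ≈ 0#)) →
  (∀ k → Q 0 k ≈ 1#) →
  (∀ k → Q (suc r) k ≈ 1#) →
  (∀ a k → 1 ≤ a → a ≤ r →
     (Q a (k ℤ.+ + 1) * Q a (k ℤ.- + 1)) ≈ ((Q a k * Q a k) + (Q (suc a) k * Q (a ∸ 1) k))) →
  (h : ℤ × ℤ) (k : ℤ) →
  Hamiltonian.H F r h (Hamiltonian.qArgs F r Q k)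
    ≈ Hamiltonian.H F r h (Hamiltonian.qArgs F r Q (k ℤ.+ + 1))
theorem5p1 F r _ = Conservation.H-conserved F r
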